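{- Let $w\in S_\infty$ and $i\geq1$ with $\ell(s_iw)>\ell(w)$, and let $k\leq l$. Then $\tilde B_{k,l}(s_iw)$ consists of the elements of $\tilde B_{k,l}(w)$, their $s_i$-images, and the sums $\alpha+s_i\beta$ with $\alpha\in A_{l,i}(w)$ and $\beta\in A_{k,i}(w)$. The set $B_{k,l}(s_iw)$ consists of the elements of $B_{k,l}(w)$, their $s_i$-images, and the same sums $\alpha+s_i\beta$, except that when $k=l$ the sums $\alpha+s_i\alpha$ with $\alpha\in A_{l,i}(w)$ are excluded. Both $\tilde B_{k,l}(s_iw)$ and $B_{k,l}(s_iw)$ are preserved under the action of $s_i$.
   Context: $S_\infty$ is the group of permutations of the positive integers fixing all but finitely many; permutations compose as functions, $s_i$ is the transposition of $i,i+1$, and $\ell(w)$ is the number of inversions of $w$. For $m\geq1$, $w^m$ is the increasing ordering of $w(1),\dots,w(m)$; for strictly increasing sequences of equal length, $\alpha\leq\gamma$ means entrywise $\leq$. $A_m(w)$ is the set of strictly increasing sequences of $m$ positive integers that are $\leq w^m$; sequences are identified with finite sets. For such $\alpha$, $s_i\alpha$ is the increasing sequence with entry set $\{s_i(\alpha_j)\}$, and $A_{m,i}(w):=\{\alpha\in A_m(w):s_i\alpha\notin A_m(w)\}$. Multi-sets with multiplicities at most 2 are written $\eta=\eta_1+2\eta_2$; for sets, $\alpha+\beta$ is multi-set union; $s_i$ acts on multi-sets by interchanging the multiplicities of $i$ and $i+1$. For $k\leq l$: $\tilde B_{k,l}(w)$ is the set of $\alpha+\beta$ with $\alpha\in A_l(w)$,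 $\beta\in A_k(w)$; $B_{k,l}(w)$ is the set of $\eta$ for which there are $\alpha,\tilde\alpha\in A_l(w)$, $\beta,\tilde\beta\in A_k(w)$ with $\eta=\alpha+\beta=\tilde\alpha+\tilde\beta$ and $\alpha\neq\tilde\alpha$, $\alpha\neq\tilde\beta$, $\beta\neq\tilde\alpha$, $\beta\neq\tilde\beta$. -}

module Defs where

open import Data.Nat using (ℕ; zero; suc; _≤_; _<_; _<?_; NonZero; z≤n; s≤s; _+_; _∸_)
open import Data.Nat.ListAction using (sum)
open import Data.Nat.Properties using (≤-decTotalOrder; ≤-trans)
open import Data.List using (List; []; _∷_; map; length; filter; applyUpTo; _++_)
open import Data.List.Relation.Unary.All using (All)
open import Data.List.Relation.Unary.Linked using (Linked)
open import Data.List.Relation.Binary.Pointwise using (Pointwise)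
open import Data.List.Sort ≤-decTotalOrder using (sort)
open import Data.Product using (Σ; _×_; ∃; ∃-syntax)
open import Relation.Nullary using (¬_)
open import Relation.Binary.PropositionalEquality using (_≡_; _≢_; refl; cong; trans)

-- S_∞ : permutations of the positive integers fixing all but finitely
-- many.  Represented as a bijection of ℕ (with explicit inverse) that
-- fixes 0 (so it is really a permutation of the positive integers) and
-- fixes every n ≥ bound.

record FinPerm : Set where
  field
    fun     : ℕ → ℕ
    inv     : ℕ → ℕ
    fun-inv : ∀ n → fun (inv n) ≡ n
    inv-fun : ∀ n → inv (fun n) ≡ n
    fix0    : fun 0 ≡ 0
    bound   : ℕ
    fixed   : ∀ n → bound ≤ n → fun n ≡ n

open FinPerm public

-- the transposition s_i of i and i+1 (as a function on ℕ)
tr : ℕ → ℕ → ℕ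
tr zero zero = 1
tr zero (suc zero) = 0
tr zero (suc (suc x)) = suc (suc x)
tr (suc i) zero = zero
tr (suc i) (suc x) = suc (tr i x)

tr-tr : ∀ i x → tr i (tr i x) ≡ x
tr-tr zero zero = refl
tr-tr zero (suc zero) = refl
tr-tr zero (suc (suc x)) = refl
tr-tr (suc i) zero = refl
tr-tr (suc i) (suc x) = cong suc (tr-tr i x)

tr-fixed : ∀ i x → suc (suc i) ≤ x → tr i x ≡ x
tr-fixed zero (suc zero) (s≤s ())
tr-fixed zero (suc (suc x)) _ = refl
tr-fixed (suc i) (suc x) (s≤s p) = cong suc (tr-fixed i x p)

tr-0 : ∀ i → .{{_ : NonZero i}} → tr i 0 ≡ 0
tr-0 (suc i) = refl

max : ℕ → ℕ → ℕ
max zero n = n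
max (suc m) zero = suc m
max (suc m) (suc n) = suc (max m n)

max-≤ˡ : ∀ m n {k} → max m n ≤ k → m ≤ k
max-≤ˡ zero n p = z≤n
max-≤ˡ (suc m) zero p = p
max-≤ˡ (suc m) (suc n) (s≤s p) = s≤s (max-≤ˡ m n p)

max-≤ʳ : ∀ m n {k} → max m n ≤ k → n ≤ k
max-≤ʳ zero n p = p
max-≤ʳ (suc m) zero p = z≤n
max-≤ʳ (suc m) (suc n) (s≤s p) = s≤s (max-≤ʳ m n p)

s[_]∘ : (i : ℕ) → .{{_ : NonZero i}} → FinPerm → FinPerm
s[ i ]∘ w = record
  { fun     = λ n → tr i (fun w n)
  ; inv     = λ n → inv w (tr i n)
  ; fun-inv = λ n → trans (cong (tr i) (fun-inv w (tr i n))) (tr-tr i n)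
  ; inv-fun = λ n → trans (cong (inv w) (tr-tr i (fun w n))) (inv-fun w n)
  ; fix0    = trans (cong (tr i) (fix0 w)) (tr-0 i)
  ; bound   = max (bound w) (suc (suc i))
  ; fixed   = λ n p → trans (cong (tr i) (fixed w n (max-≤ˡ (bound w) _ p)))
                            (tr-fixed i n (max-≤ʳ (bound w) _ p))
  }

-- ℓ(w): number of inversions, i.e. pairs 1 ≤ a < b with w a > w b.
-- All inversions have b < bound w, so it suffices to count those.
range : ℕ → ℕ → List ℕ
range a b = applyUpTo (a +_) (b ∸ a)

inversionsBelow : ℕ → (ℕ → ℕ) → ℕ
inversionsBelow N f =
  sum (map (λ b → length (filter (λ a → f b <? f a) (range 1 b))) (range 1 N))

ℓ : FinPerm → ℕ
ℓ w = inversionsBelow (bound w) (fun w)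

-- Strictly increasing sequences (= finite sets) and multisets,
-- represented as (sorted) lists of natural numbers.

_^[_] : FinPerm → ℕ → List ℕ
w ^[ m ] = sort (applyUpTo (λ j → fun w (suc j)) m)

IncSeq : ℕ → List ℕ → Set
IncSeq m α = length α ≡ m × Linked _<_ α × All (1 ≤_) α

A : ℕ → FinPerm → List ℕ → Set
A m w α = IncSeq m α × Pointwise _≤_ α (w ^[ m ])

-- s_i acting on sets / multi-sets (sorted lists): apply s_i to each
-- entry and re-sort (for multi-sets this interchanges the
-- multiplicities of i and i+1)
s[_]· : ℕ → List ℕ → List ℕ
s[ i ]· α = sort (map (tr i) α)

Ai : ℕ → ℕ → FinPerm → List ℕ → Set
Ai m i w α = A m w α × ¬ A m w (s[ i ]· α)

_⊕_ : List ℕ → List ℕ → List ℕ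
α ⊕ β = sort (α ++ β)

B̃ : ℕ → ℕ → FinPerm → List ℕ → Set
B̃ k l w η = ∃[ α ] ∃[ β ] A l w α × A k w β × η ≡ α ⊕ β

B : ℕ → ℕ → FinPerm → List ℕ → Set
B k l w η = ∃[ α ] ∃[ α' ] ∃[ β ] ∃[ β' ]
  A l w α × A l w α' × A k w β × A k w β' ×
  η ≡ α ⊕ β × η ≡ α' ⊕ β' ×
  α ≢ α' × α ≢ β' × β ≢ α' × β ≢ β'

-- Write A_m(w) through tail counts #≥ t α = #{a ∈ α | a ≥ t}: for sorted lists of equal length,
-- entrywise α ≤ w^m is equivalent to #≥ t α ≤ #≥ t (w(1), …, w(m)) for every t.
-- Since ℓ(s_i w) > ℓ(w), w⁻¹(i) < w⁻¹(i+1), so a prefix w(1), …, w(m) containing i+1 contains i.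
-- Hence the tail counts of s_i w agree with those of w except at t = i+1, where they may
-- grow by one.  It follows that A_m(s_i w) = A_m(w) ∪ s_i A_m(w), that s_i A_m(w) ∖ A_m(w)
-- is s_i A_{m,i}(w), and that each α ∈ A_{m,i}(w) contains i, not i+1, and is tight at i+1.
-- This settles B̃ and the s_i-stability.  For B, the only new decompositions α + β pair an
-- element of some A_{·,i}(w) with a partner containing i+1 but not i.  If the partner lies in
-- A(w), trading i+1 (resp. i) for the first element above (resp. last below) where the two sets
-- differ gives a second decomposition inside A(w); otherwise the sum is some α + s_i β.
-- When k = l, the summands of any decomposition of α + s_i α are α and s_i α, which forbids
-- four distinct summands.

module Submission where

open import Defs
open import Data.Nat
open import Data.Nat.Properties
open import Data.Nat.ListAction using (sum)
open import Data.Nat.ListAction.Properties using (sum-++; sum-↭)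
open import Data.List using (List; []; _∷_; _++_; map; length; applyUpTo; filter)
open import Data.List.Properties
  using (map-++; map-∘; map-cong; length-map; length-applyUpTo; map-applyUpTo; applyUpTo-∷ʳ; filter-none)
open import Data.List.Relation.Unary.All.Properties using (applyUpTo⁺₁)
open import Data.List.Relation.Unary.Linked as Linked using (Linked; []; [-]; _∷_; tail)
open import Data.List.Relation.Unary.Linked.Properties using (Linked⇒All)
open import Data.List.Relation.Unary.All as All using (All; []; _∷_)
open import Data.List.Relation.Binary.Pointwise using (Pointwise; []; _∷_)
open import Data.List.Relation.Binary.Permutation.Propositional.Properties as ↭ using (↭-length)
open import Data.List.Sort ≤-decTotalOrder using (sort; sort-↗; sort-↭)
open import Data.Product using (_×_; _,_; proj₁; proj₂; ∃-syntax)
open import Data.Sum using (_⊎_; inj₁; inj₂)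
open import Data.Empty using (⊥-elim)
open import Relation.Nullary using (¬_; Dec; yes; no)
open import Relation.Unary using (Decidable)
open import Relation.Binary.Definitions using (tri<; tri≈; tri>)
open import Relation.Binary.PropositionalEquality hiding ([_])
open import Function using (_∘_; case_of_)
open import Function.Bundles using (_⇔_; mk⇔)
open import Algebra.Properties.CommutativeSemigroup +-commutativeSemigroup using (interchange; x∙yz≈xz∙y; x∙yz≈y∙xz)

-- Iverson brackets and sums over lists

[_≡_] : ℕ → ℕ → ℕ
[ zero ≡ zero ] = 1
[ zero ≡ suc b ] = 0
[ suc a ≡ zero ] = 0
[ suc a ≡ suc b ] = [ a ≡ b ]

[_≤_] : ℕ → ℕ → ℕ
[ zero ≤ a ] = 1
[ suc t ≤ zero ] = 0
[ suc t ≤ suc a ] = [ t ≤ a ]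

[≡]-refl : ∀ a → [ a ≡ a ] ≡ 1
[≡]-refl zero = refl
[≡]-refl (suc a) = [≡]-refl a

[≡]-≢ : ∀ {a b} → a ≢ b → [ a ≡ b ] ≡ 0
[≡]-≢ {zero} {zero} a≢b = ⊥-elim (a≢b refl)
[≡]-≢ {zero} {suc b} a≢b = refl
[≡]-≢ {suc a} {zero} a≢b = refl
[≡]-≢ {suc a} {suc b} a≢b = [≡]-≢ (a≢b ∘ cong suc)

[≡]>0⇒≡ : ∀ {a b} → 0 < [ a ≡ b ] → a ≡ b
[≡]>0⇒≡ {zero} {zero} _ = refl
[≡]>0⇒≡ {suc a} {suc b} p = cong suc ([≡]>0⇒≡ p)

[≤]-yes : ∀ {t a} → t ≤ a → [ t ≤ a ] ≡ 1
[≤]-yes z≤n = refl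
[≤]-yes (s≤s t≤a) = [≤]-yes t≤a

[≤]-no : ∀ {t a} → a < t → [ t ≤ a ] ≡ 0
[≤]-no {suc t} {zero} _ = refl
[≤]-no {suc t} {suc a} (s≤s a<t) = [≤]-no a<t

[≤]>0⇒≤ : ∀ {t a} → 0 < [ t ≤ a ] → t ≤ a
[≤]>0⇒≤ {zero} _ = z≤n
[≤]>0⇒≤ {suc t} {suc a} p = s≤s ([≤]>0⇒≤ p)

[≤]-split : ∀ t a → [ t ≤ a ] ≡ [ a ≡ t ] + [ suc t ≤ a ]
[≤]-split zero zero = refl
[≤]-split zero (suc a) = refl
[≤]-split (suc t) zero = refl
[≤]-split (suc t) (suc a) = [≤]-split t a

[≤]-monoʳ : ∀ t {a b} → a ≤ b → [ t ≤ a ] ≤ [ t ≤ b ]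
[≤]-monoʳ zero _ = ≤-refl
[≤]-monoʳ (suc t) {zero} _ = z≤n
[≤]-monoʳ (suc t) {suc a} (s≤s a≤b) = [≤]-monoʳ t a≤b

[≤]-antimonoˡ : ∀ {s t} a → s ≤ t → [ t ≤ a ] ≤ [ s ≤ a ]
[≤]-antimonoˡ {zero} {zero} a _ = ≤-refl
[≤]-antimonoˡ {zero} {suc t} zero _ = z≤n
[≤]-antimonoˡ {zero} {suc t} (suc a) _ = [≤]-antimonoˡ a (z≤n {t})
[≤]-antimonoˡ {suc s} {suc t} zero _ = ≤-refl
[≤]-antimonoˡ {suc s} {suc t} (suc a) (s≤s s≤t) = [≤]-antimonoˡ a s≤t

∑ : (ℕ → ℕ) → List ℕ → ℕ
∑ f x = sum (map f x)

∑-cong : ∀ {f g} → (∀ a → f a ≡ g a) → ∀ x → ∑ f x ≡ ∑ g x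
∑-cong f≗g x = cong sum (map-cong f≗g x)

∑-mono : ∀ {f g} → (∀ a → f a ≤ g a) → ∀ x → ∑ f x ≤ ∑ g x
∑-mono f≤g [] = z≤n
∑-mono f≤g (a ∷ x) = +-mono-≤ (f≤g a) (∑-mono f≤g x)

∑-+ : ∀ f g x → ∑ (λ a → f a + g a) x ≡ ∑ f x + ∑ g x
∑-+ f g [] = refl
∑-+ f g (a ∷ x) = trans (cong (f a + g a +_) (∑-+ f g x)) (interchange (f a) (g a) (∑ f x) (∑ g x))

∑-++ : ∀ f x y → ∑ f (x ++ y) ≡ ∑ f x + ∑ f y
∑-++ f x y = trans (cong sum (map-++ f x y)) (sum-++ (map f x) (map f y))

∑-map : ∀ f g x → ∑ f (map g x) ≡ ∑ (λ a → f (g a)) x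
∑-map f g x = cong sum (sym (map-∘ x))

∑-sort : ∀ f x → ∑ f (sort x) ≡ ∑ f x
∑-sort f x = sum-↭ (↭.map⁺ f (sort-↭ x))

-- Multiplicities and tail counts

mult : List ℕ → ℕ → ℕ
mult x n = ∑ [_≡ n ] x

#≥ : ℕ → List ℕ → ℕ
#≥ t x = ∑ [ t ≤_] x

_∈ₘ_ : ℕ → List ℕ → Set
n ∈ₘ x = mult x n ≡ 1

_∉ₘ_ : ℕ → List ℕ → Set
n ∉ₘ x = mult x n ≡ 0

∈ₘ⇒≢∉ₘ : ∀ {n x y} → n ∈ₘ x → n ∉ₘ y → x ≢ y
∈ₘ⇒≢∉ₘ n∈x n∉y refl = 1+n≢0 (trans (sym n∈x) n∉y)

#≥0≡length : ∀ x → #≥ 0 x ≡ length x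
#≥0≡length [] = refl
#≥0≡length (a ∷ x) = cong suc (#≥0≡length x)

#≥-split : ∀ t x → #≥ t x ≡ mult x t + #≥ (suc t) x
#≥-split t x = trans (∑-cong ([≤]-split t) x) (∑-+ [_≡ t ] [ suc t ≤_] x)

#≥-split₂ : ∀ i X → #≥ i X ≡ mult X i + mult X (suc i) + #≥ (suc (suc i)) X
#≥-split₂ i X = trans (#≥-split i X) (trans (cong (mult X i +_) (#≥-split (suc i) X)) (sym (+-assoc (mult X i) _ _)))

#≥-antimonoˡ : ∀ {s t} → s ≤ t → ∀ x → #≥ t x ≤ #≥ s x
#≥-antimonoˡ s≤t = ∑-mono (λ a → [≤]-antimonoˡ a s≤t)

#≥≤length : ∀ t x → #≥ t x ≤ length x
#≥≤length t x = subst (#≥ t x ≤_) (#≥0≡length x) (#≥-antimonoˡ (z≤n {t}) x)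

#≥-all : ∀ {t x} → All (t ≤_) x → #≥ t x ≡ length x
#≥-all [] = refl
#≥-all (t≤a ∷ t≤x) = cong₂ _+_ ([≤]-yes t≤a) (#≥-all t≤x)

mult-sort : ∀ x n → mult (sort x) n ≡ mult x n
mult-sort x n = ∑-sort [_≡ n ] x

mult-head : ∀ a x → 0 < mult (a ∷ x) a
mult-head a x = subst (λ m → 0 < m + mult x a) (sym ([≡]-refl a)) (s≤s z≤n)

head-≤-member : ∀ {a x n} → Linked _≤_ (a ∷ x) → 0 < mult (a ∷ x) n → a ≤ n
head-≤-member {a} {x} {n} x↗ n∈ with [ a ≡ n ] in eq
... | suc _ = ≤-reflexive ([≡]>0⇒≡ (subst (0 <_) (sym eq) (s≤s z≤n)))
head-≤-member {a} {b ∷ x} (a≤b ∷ x↗) n∈ | zero = ≤-trans a≤b (head-≤-member x↗ n∈)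

↗-ext : ∀ {x y} → Linked _≤_ x → Linked _≤_ y → (∀ n → mult x n ≡ mult y n) → x ≡ y
↗-ext {[]} {[]} _ _ _ = refl
↗-ext {[]} {b ∷ y} _ _ x≈y = case subst (0 <_) (sym (x≈y b)) (mult-head b y) of λ ()
↗-ext {a ∷ x} {[]} _ _ x≈y = case subst (0 <_) (x≈y a) (mult-head a x) of λ ()
↗-ext {a ∷ x} {b ∷ y} x↗ y↗ x≈y = cong₂ _∷_ a≡b (↗-ext (tail x↗) (tail y↗) tails)
  where
  a≡b : a ≡ b
  a≡b = ≤-antisym (head-≤-member x↗ (subst (0 <_) (sym (x≈y b)) (mult-head b y)))
                  (head-≤-member y↗ (subst (0 <_) (x≈y a) (mult-head a x)))
  tails : ∀ n → mult x n ≡ mult y n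
  tails n = +-cancelˡ-≡ [ a ≡ n ] _ _ (trans (x≈y n) (cong (λ c → [ c ≡ n ] + mult y n) (sym a≡b)))

-- Finite sets of positive integers as sorted lists

record IsPosSet (α : List ℕ) : Set where
  field
    sorted : Linked _≤_ α
    mult≤1 : ∀ n → mult α n ≤ 1
    0∉ : mult α 0 ≡ 0

open IsPosSet public

private
  head<tail : ∀ {a x} → Linked _<_ (a ∷ x) → All (a <_) x
  head<tail [-] = []
  head<tail (a<b ∷ x↗) = Linked⇒All <-trans a<b x↗

  mult-above-head : ∀ {a x} → All (a <_) x → mult x a ≡ 0
  mult-above-head [] = refl
  mult-above-head (a<b ∷ a<x) = cong₂ _+_ ([≡]-≢ (>⇒≢ a<b)) (mult-above-head a<x)

  strict⇒mult≤1 : ∀ {x} → Linked _<_ x → ∀ n → mult x n ≤ 1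
  strict⇒mult≤1 {[]} _ n = z≤n
  strict⇒mult≤1 {a ∷ x} x↗ n with a ≟ n
  ... | yes refl = ≤-reflexive (cong₂ _+_ ([≡]-refl a) (mult-above-head (head<tail x↗)))
  ... | no a≢n = subst (_≤ 1) (cong (_+ mult x n) (sym ([≡]-≢ a≢n))) (strict⇒mult≤1 (tail x↗) n)

  mult≤1⇒strict : ∀ {x} → Linked _≤_ x → (∀ n → mult x n ≤ 1) → Linked _<_ x
  mult≤1⇒strict [] _ = []
  mult≤1⇒strict [-] _ = [-]
  mult≤1⇒strict {a ∷ b ∷ x} (a≤b ∷ x↗) ≤1 =
    ≤∧≢⇒< a≤b a≢b ∷ mult≤1⇒strict x↗ (λ n → ≤-trans (m≤n+m _ [ a ≡ n ]) (≤1 n))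
    where
    a≢b : a ≢ b
    a≢b refl = case subst (_≤ 1) (cong (λ m → m + (m + mult x a)) ([≡]-refl a)) (≤1 a) of λ where
      (s≤s ())

  positive⇒0∉ : ∀ {x} → All (1 ≤_) x → mult x 0 ≡ 0
  positive⇒0∉ [] = refl
  positive⇒0∉ (s≤s z≤n ∷ x>0) = positive⇒0∉ x>0

  0∉⇒positive : ∀ x → mult x 0 ≡ 0 → All (1 ≤_) x
  0∉⇒positive [] _ = []
  0∉⇒positive (suc a ∷ x) 0∉x = s≤s z≤n ∷ 0∉⇒positive x 0∉x

IncSeq⇒IsPosSet : ∀ {m α} → IncSeq m α → IsPosSet α
IncSeq⇒IsPosSet (_ , α↗ , α>0) = record
  { sorted = Linked.map <⇒≤ α↗ ; mult≤1 = strict⇒mult≤1 α↗ ; 0∉ = positive⇒0∉ α>0 }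

IncSeq⇒sorted : ∀ {m α} → IncSeq m α → Linked _≤_ α
IncSeq⇒sorted = sorted ∘ IncSeq⇒IsPosSet

IsPosSet⇒IncSeq : ∀ {m α} → length α ≡ m → IsPosSet α → IncSeq m α
IsPosSet⇒IncSeq {α = α} |α|≡m S = |α|≡m , mult≤1⇒strict (sorted S) (mult≤1 S) , 0∉⇒positive α (0∉ S)

mult-⊕ : ∀ α β n → mult (α ⊕ β) n ≡ mult α n + mult β n
mult-⊕ α β n = trans (mult-sort (α ++ β) n) (∑-++ [_≡ n ] α β)

⊕-comm : ∀ α β → α ⊕ β ≡ β ⊕ α
⊕-comm α β = ↗-ext (sort-↗ (α ++ β)) (sort-↗ (β ++ α)) λ n →
  trans (mult-⊕ α β n) (trans (+-comm (mult α n) (mult β n)) (sym (mult-⊕ β α n)))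

-- The action of s_i

tr-i : ∀ i → tr i i ≡ suc i
tr-i zero = refl
tr-i (suc i) = cong suc (tr-i i)

tr-i+1 : ∀ i → tr i (suc i) ≡ i
tr-i+1 zero = refl
tr-i+1 (suc i) = cong suc (tr-i+1 i)

tr-other : ∀ i {n} → n ≢ i → n ≢ suc i → tr i n ≡ n
tr-other zero {zero} n≢i _ = ⊥-elim (n≢i refl)
tr-other zero {suc zero} _ n≢i+1 = ⊥-elim (n≢i+1 refl)
tr-other zero {suc (suc n)} _ _ = refl
tr-other (suc i) {zero} _ _ = refl
tr-other (suc i) {suc n} n≢i n≢i+1 = cong suc (tr-other i (n≢i ∘ cong suc) (n≢i+1 ∘ cong suc))

data Position (i n : ℕ) : Set where
  at-i : n ≡ i → Position i n
  at-i+1 : n ≡ suc i → Position i n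
  elsewhere : n ≢ i → n ≢ suc i → Position i n

position : ∀ i n → Position i n
position i n with n ≟ i | n ≟ suc i
... | yes n≡i | _ = at-i n≡i
... | no _ | yes n≡i+1 = at-i+1 n≡i+1
... | no n≢i | no n≢i+1 = elsewhere n≢i n≢i+1

[≡]-tr : ∀ i a n → [ tr i a ≡ n ] ≡ [ a ≡ tr i n ]
[≡]-tr i a n with a ≟ tr i n
... | yes refl = trans (cong [_≡ n ] (tr-tr i n)) (trans ([≡]-refl n) (sym ([≡]-refl (tr i n))))
... | no a≢trn = trans ([≡]-≢ λ e → a≢trn (trans (sym (tr-tr i a)) (cong (tr i) e))) (sym ([≡]-≢ a≢trn))

[≤]-tr : ∀ i {t} a → t ≢ suc i → [ t ≤ tr i a ] ≡ [ t ≤ a ]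
[≤]-tr zero {zero} a _ = refl
[≤]-tr zero {suc zero} a t≢1 = ⊥-elim (t≢1 refl)
[≤]-tr zero {suc (suc t)} zero _ = refl
[≤]-tr zero {suc (suc t)} (suc zero) _ = refl
[≤]-tr zero {suc (suc t)} (suc (suc a)) _ = refl
[≤]-tr (suc i) {zero} a _ = refl
[≤]-tr (suc i) {suc t} zero _ = refl
[≤]-tr (suc i) {suc t} (suc a) t≢i+1 = [≤]-tr i a (t≢i+1 ∘ cong suc)

[≤]-tr-at-i+1 : ∀ i a → [ suc i ≤ tr i a ] ≡ [ suc (suc i) ≤ a ] + [ a ≡ i ]
[≤]-tr-at-i+1 zero zero = refl
[≤]-tr-at-i+1 zero (suc zero) = refl
[≤]-tr-at-i+1 zero (suc (suc a)) = refl
[≤]-tr-at-i+1 (suc i) zero = refl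
[≤]-tr-at-i+1 (suc i) (suc a) = [≤]-tr-at-i+1 i a

mult-map-tr : ∀ i x n → mult (map (tr i) x) n ≡ mult x (tr i n)
mult-map-tr i x n = trans (∑-map [_≡ n ] (tr i) x) (∑-cong (λ a → [≡]-tr i a n) x)

#≥-map-tr : ∀ i {t} x → t ≢ suc i → #≥ t (map (tr i) x) ≡ #≥ t x
#≥-map-tr i x t≢i+1 = trans (∑-map _ (tr i) x) (∑-cong (λ a → [≤]-tr i a t≢i+1) x)

#≥-map-tr-at-i+1 : ∀ i x → #≥ (suc i) (map (tr i) x) ≡ #≥ (suc (suc i)) x + mult x i
#≥-map-tr-at-i+1 i x = trans (∑-map _ (tr i) x)
  (trans (∑-cong ([≤]-tr-at-i+1 i) x) (∑-+ [ suc (suc i) ≤_] [_≡ i ] x))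

mult-s : ∀ i α n → mult (s[ i ]· α) n ≡ mult α (tr i n)
mult-s i α n = trans (mult-sort (map (tr i) α) n) (mult-map-tr i α n)

#≥-s : ∀ i {t} α → t ≢ suc i → #≥ t (s[ i ]· α) ≡ #≥ t α
#≥-s i α t≢i+1 = trans (∑-sort _ (map (tr i) α)) (#≥-map-tr i α t≢i+1)

#≥-s-at-i+1 : ∀ i α → #≥ (suc i) (s[ i ]· α) ≡ #≥ (suc (suc i)) α + mult α i
#≥-s-at-i+1 i α = trans (∑-sort _ (map (tr i) α)) (#≥-map-tr-at-i+1 i α)

s-involutive : ∀ i {α} → Linked _≤_ α → s[ i ]· (s[ i ]· α) ≡ α
s-involutive i {α} α↗ = ↗-ext (sort-↗ _) α↗ λ n →
  trans (mult-s i (s[ i ]· α) n) (trans (mult-s i α (tr i n)) (cong (mult α) (tr-tr i n)))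

s-injective : ∀ i {α β} → Linked _≤_ α → Linked _≤_ β → s[ i ]· α ≡ s[ i ]· β → α ≡ β
s-injective i {α} {β} α↗ β↗ e = trans (sym (s-involutive i α↗)) (trans (cong s[ i ]· e) (s-involutive i β↗))

s-⊕ : ∀ i α β → s[ i ]· (α ⊕ β) ≡ s[ i ]· α ⊕ s[ i ]· β
s-⊕ i α β = ↗-ext (sort-↗ _) (sort-↗ _) λ n → begin
  mult (s[ i ]· (α ⊕ β)) n                 ≡⟨ mult-s i (α ⊕ β) n ⟩
  mult (α ⊕ β) (tr i n)                    ≡⟨ mult-⊕ α β (tr i n) ⟩
  mult α (tr i n) + mult β (tr i n)        ≡⟨ cong₂ _+_ (mult-s i α n) (mult-s i β n) ⟨
  mult (s[ i ]· α) n + mult (s[ i ]· β) n  ≡⟨ mult-⊕ (s[ i ]· α) (s[ i ]· β) n ⟨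
  mult (s[ i ]· α ⊕ s[ i ]· β) n           ∎
  where open ≡-Reasoning

s-fixes-balanced : ∀ i {η} → Linked _≤_ η → mult η i ≡ mult η (suc i) → s[ i ]· η ≡ η
s-fixes-balanced i {η} η↗ balanced = ↗-ext (sort-↗ _) η↗ λ n → trans (mult-s i η n) (swapped n)
  where
  swapped : ∀ n → mult η (tr i n) ≡ mult η n
  swapped n with position i n
  ... | at-i refl = trans (cong (mult η) (tr-i i)) (sym balanced)
  ... | at-i+1 refl = trans (cong (mult η) (tr-i+1 i)) balanced
  ... | elsewhere n≢i n≢i+1 = cong (mult η) (tr-other i n≢i n≢i+1)

mult-s-at-i : ∀ i α → mult (s[ i ]· α) i ≡ mult α (suc i)
mult-s-at-i i α = trans (mult-s i α i) (cong (mult α) (tr-i i))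

mult-s-at-i+1 : ∀ i α → mult (s[ i ]· α) (suc i) ≡ mult α i
mult-s-at-i+1 i α = trans (mult-s i α (suc i)) (cong (mult α) (tr-i+1 i))

s-fixes-opposites : ∀ i {X Y} → i ∉ₘ X → suc i ∈ₘ X → i ∈ₘ Y → suc i ∉ₘ Y → s[ i ]· (X ⊕ Y) ≡ X ⊕ Y
s-fixes-opposites i {X} {Y} i∉X i+1∈X i∈Y i+1∉Y = s-fixes-balanced i (sort-↗ (X ++ Y)) (begin
  mult (X ⊕ Y) i                   ≡⟨ mult-⊕ X Y i ⟩
  mult X i + mult Y i              ≡⟨ cong₂ _+_ (trans i∉X (sym i+1∉Y)) (trans i∈Y (sym i+1∈X)) ⟩
  mult Y (suc i) + mult X (suc i)  ≡⟨ +-comm (mult Y (suc i)) _ ⟩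
  mult X (suc i) + mult Y (suc i)  ≡⟨ mult-⊕ X Y (suc i) ⟨
  mult (X ⊕ Y) (suc i)             ∎)
  where open ≡-Reasoning

s-IncSeq : ∀ i .{{_ : NonZero i}} {m α} → IncSeq m α → IncSeq m (s[ i ]· α)
s-IncSeq i {α = α} α-inc = IsPosSet⇒IncSeq
  (trans (↭-length (sort-↭ _)) (trans (length-map (tr i) α) (proj₁ α-inc)))
  (record
    { sorted = sort-↗ _
    ; mult≤1 = λ n → subst (_≤ 1) (sym (mult-s i α n)) (mult≤1 S (tr i n))
    ; 0∉ = trans (mult-s i α 0) (trans (cong (mult α) (tr-0 i)) (0∉ S)) })
  where
  S : IsPosSet α
  S = IncSeq⇒IsPosSet α-inc

-- Entrywise comparison of sorted lists through tail counts

_≼_ : List ℕ → List ℕ → Set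
x ≼ y = ∀ t → #≥ t x ≤ #≥ t y

Pointwise⇒≼ : ∀ {x y} → Pointwise _≤_ x y → x ≼ y
Pointwise⇒≼ [] t = z≤n
Pointwise⇒≼ (a≤b ∷ x≤y) t = +-mono-≤ ([≤]-monoʳ t a≤b) (Pointwise⇒≼ x≤y t)

≼⇒Pointwise : ∀ {x y} → Linked _≤_ x → Linked _≤_ y → length x ≡ length y → x ≼ y → Pointwise _≤_ x y
≼⇒Pointwise {[]} {[]} _ _ _ _ = []
≼⇒Pointwise {a ∷ x} {b ∷ y} x↗ y↗ |x|≡|y| x≼y = a≤b ∷ ≼⇒Pointwise (tail x↗) (tail y↗) |x|≡|y|′ tails
  where
  |x|≡|y|′ : length x ≡ length y
  |x|≡|y|′ = suc-injective |x|≡|y|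
  x≥a : All (a ≤_) x
  x≥a = All.tail (Linked⇒All ≤-trans ≤-refl x↗)
  y≥b : All (b ≤_) y
  y≥b = All.tail (Linked⇒All ≤-trans ≤-refl y↗)
  a≤b : a ≤ b
  a≤b = [≤]>0⇒≤ (+-cancelʳ-≤ (length y) 1 [ a ≤ b ] (begin
    suc (length y)         ≡⟨ trans (sym |x|≡|y|) (sym (#≥-all (≤-refl ∷ x≥a))) ⟩
    #≥ a (a ∷ x)           ≤⟨ x≼y a ⟩
    [ a ≤ b ] + #≥ a y     ≤⟨ +-monoʳ-≤ [ a ≤ b ] (#≥≤length a y) ⟩
    [ a ≤ b ] + length y   ∎))
    where open ≤-Reasoning
  tails : x ≼ y
  tails t with t ≤? b
  ... | yes t≤b = begin
    #≥ t x    ≤⟨ #≥≤length t x ⟩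
    length x  ≡⟨ |x|≡|y|′ ⟩
    length y  ≡⟨ #≥-all (All.map (≤-trans t≤b) y≥b) ⟨
    #≥ t y    ∎
    where open ≤-Reasoning
  ... | no t≰b = +-cancelˡ-≤ 0 _ _ (subst₂ _≤_
    (cong (_+ #≥ t x) ([≤]-no (<-≤-trans (≤-<-trans a≤b (≰⇒> t≰b)) ≤-refl)))
    (cong (_+ #≥ t y) ([≤]-no (≰⇒> t≰b)))
    (x≼y t))

prefix : FinPerm → ℕ → List ℕ
prefix w m = applyUpTo (λ j → fun w (suc j)) m

A≼ : ℕ → FinPerm → List ℕ → Set
A≼ m w α = IncSeq m α × α ≼ prefix w m

A⇒A≼ : ∀ {m w α} → A m w α → A≼ m w α
A⇒A≼ {m} {w} (α-inc , α≤w^m) = α-inc , λ t → subst (_ ≤_) (∑-sort _ (prefix w m)) (Pointwise⇒≼ α≤w^m t)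

A≼⇒A : ∀ {m w α} → A≼ m w α → A m w α
A≼⇒A {m} {w} (α-inc , α≼) = α-inc , ≼⇒Pointwise (sorted (IncSeq⇒IsPosSet α-inc)) (sort-↗ _)
  (trans (proj₁ α-inc) (sym (trans (↭-length (sort-↭ _)) (length-applyUpTo _ m))))
  (λ t → subst (_ ≤_) (sym (∑-sort _ (prefix w m))) (α≼ t))

-- An ascent of w from ℓ(s_i w) > ℓ(w)

fun-injective : ∀ w {a b} → fun w a ≡ fun w b → a ≡ b
fun-injective w {a} {b} e = trans (sym (inv-fun w a)) (trans (cong (inv w) e) (inv-fun w b))

fun-<-bound : ∀ w {a} → a < bound w → fun w a < bound w
fun-<-bound w {a} a<B with fun w a <? bound w
... | yes wa<B = wa<B
... | no wa≮B = ⊥-elim (<-irrefl refl (<-≤-trans a<B (subst (bound w ≤_) wa≡a (≮⇒≥ wa≮B))))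
  where
  wa≡a : fun w a ≡ a
  wa≡a = fun-injective w (fixed w (fun w a) (≮⇒≥ wa≮B))

private
  inversionsAt : (ℕ → ℕ) → ℕ → ℕ
  inversionsAt f b = length (filter (λ a → f b <? f a) (range 1 b))

  range-below : ∀ b → All (_< b) (range 1 b)
  range-below zero = []
  range-below (suc b) = applyUpTo⁺₁ suc b s≤s

  length-filter-mono : ∀ {P Q : ℕ → Set} (P? : Decidable P) (Q? : Decidable Q) {xs} →
    All (λ a → P a → Q a) xs → length (filter P? xs) ≤ length (filter Q? xs)
  length-filter-mono P? Q? [] = z≤n
  length-filter-mono P? Q? {a ∷ xs} (P⇒Q ∷ Ps⇒Qs) with P? a | Q? a
  ... | yes p | yes _ = s≤s (length-filter-mono P? Q? Ps⇒Qs)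
  ... | yes p | no ¬q = ⊥-elim (¬q (P⇒Q p))
  ... | no _ | yes _ = m≤n⇒m≤1+n (length-filter-mono P? Q? Ps⇒Qs)
  ... | no _ | no _ = length-filter-mono P? Q? Ps⇒Qs

  inversionsBelow-mono : ∀ f g N → (∀ {a b} → a < b → g b < g a → f b < f a) →
    inversionsBelow N g ≤ inversionsBelow N f
  inversionsBelow-mono f g N g⇒f = ∑-mono
    (λ b → length-filter-mono (λ a → g b <? g a) (λ a → f b <? f a) (All.map g⇒f (range-below b)))
    (range 1 N)

  inversionsBelow-suc : ∀ f N → inversionsAt f N ≡ 0 → inversionsBelow (suc N) f ≡ inversionsBelow N f
  inversionsBelow-suc f zero _ = refl
  inversionsBelow-suc f (suc N) none = begin
    ∑ I (applyUpTo suc (suc N))               ≡⟨ cong (∑ I) (applyUpTo-∷ʳ suc N) ⟨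
    ∑ I (applyUpTo suc N ++ suc N ∷ [])       ≡⟨ ∑-++ I (applyUpTo suc N) (suc N ∷ []) ⟩
    ∑ I (applyUpTo suc N) + (I (suc N) + 0)   ≡⟨ cong (λ k → ∑ I (applyUpTo suc N) + (k + 0)) none ⟩
    ∑ I (applyUpTo suc N) + 0                 ≡⟨ +-identityʳ _ ⟩
    ∑ I (applyUpTo suc N)                     ∎
    where
    open ≡-Reasoning
    I : ℕ → ℕ
    I = inversionsAt f

  inversionsBelow-stable : ∀ f B → (∀ b → B ≤ b → inversionsAt f b ≡ 0) →
    ∀ N → B ≤ N → inversionsBelow N f ≡ inversionsBelow B f
  inversionsBelow-stable f B none N B≤N with m≤n⇒m<n∨m≡n B≤N
  ... | inj₂ refl = refl
  inversionsBelow-stable f B none (suc N) _ | inj₁ B<1+N =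
    trans (inversionsBelow-suc f N (none N (<⇒≤pred B<1+N)))
          (inversionsBelow-stable f B none N (<⇒≤pred B<1+N))

  no-inversions-beyond-bound : ∀ w b → bound w ≤ b → inversionsAt (fun w) b ≡ 0
  no-inversions-beyond-bound w b B≤b = cong length (filter-none (λ a → fun w b <? fun w a)
    (All.map not-inversion (range-below b)))
    where
    wb≡b : fun w b ≡ b
    wb≡b = fixed w b B≤b
    not-inversion : ∀ {a} → a < b → ¬ fun w b < fun w a
    not-inversion {a} a<b wb<wa with a <? bound w
    ... | yes a<B = <-asym wb<wa (subst (fun w a <_) (sym wb≡b) (<-≤-trans (fun-<-bound w a<B) B≤b))
    ... | no a≮B = <-asym wb<wa (subst₂ _<_ (sym (fixed w a (≮⇒≥ a≮B))) (sym wb≡b) a<b)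

  tr-inverts-only-i : ∀ i {x y} → x < y → tr i y < tr i x → x ≡ i × y ≡ suc i
  tr-inverts-only-i zero {zero} {suc zero} _ _ = refl , refl
  tr-inverts-only-i zero {zero} {suc (suc y)} _ (s≤s ())
  tr-inverts-only-i zero {suc zero} {suc (suc y)} _ ()
  tr-inverts-only-i zero {suc (suc x)} {suc zero} (s≤s ()) _
  tr-inverts-only-i zero {suc (suc x)} {suc (suc y)} x<y y<x = ⊥-elim (<-asym x<y y<x)
  tr-inverts-only-i (suc i) {zero} {_} _ ()
  tr-inverts-only-i (suc i) {suc x} {suc y} (s≤s x<y) (s≤s y<x) with tr-inverts-only-i i x<y y<x
  ... | refl , refl = refl , refl

ascent : ∀ w i .{{_ : NonZero i}} → ℓ w < ℓ (s[ i ]∘ w) → inv w i < inv w (suc i)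
ascent w i ℓ-grows with <-cmp (inv w i) (inv w (suc i))
... | tri< p<q _ _ = p<q
... | tri≈ _ p≡q _ = ⊥-elim (1+n≢n (trans (sym (fun-inv w (suc i))) (trans (cong (fun w) (sym p≡q)) (fun-inv w i))))
... | tri> _ _ q<p = ⊥-elim (<⇒≱ ℓ-grows ℓ-shrinks)
  where
  v : FinPerm
  v = s[ i ]∘ w
  inversion-of-w : ∀ {a b} → a < b → fun v b < fun v a → fun w b < fun w a
  inversion-of-w {a} {b} a<b vb<va with <-cmp (fun w b) (fun w a)
  ... | tri< wb<wa _ _ = wb<wa
  ... | tri≈ _ wb≡wa _ = ⊥-elim (<-irrefl (cong (tr i) wb≡wa) vb<va)
  ... | tri> _ _ wa<wb with tr-inverts-only-i i wa<wb vb<va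
  ... | wa≡i , wb≡i+1 = ⊥-elim (<-asym a<b (subst₂ _<_
    (trans (cong (inv w) (sym wb≡i+1)) (inv-fun w b)) (trans (cong (inv w) (sym wa≡i)) (inv-fun w a)) q<p))
  ℓ-shrinks : ℓ v ≤ ℓ w
  ℓ-shrinks = ≤-trans (inversionsBelow-mono (fun w) (fun v) (bound v) inversion-of-w)
    (≤-reflexive (inversionsBelow-stable (fun w) (bound w) (no-inversions-beyond-bound w)
      (bound v) (max-≤ˡ (bound w) (suc (suc i)) ≤-refl)))

-- The prefixes w(1), …, w(m)

mult-applyUpTo-absent : ∀ (f : ℕ → ℕ) m {n} → (∀ {j} → j < m → f j ≢ n) → n ∉ₘ applyUpTo f m
mult-applyUpTo-absent f zero _ = refl
mult-applyUpTo-absent f (suc m) f≢n =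
  cong₂ _+_ ([≡]-≢ (f≢n (s≤s z≤n))) (mult-applyUpTo-absent (f ∘ suc) m (f≢n ∘ s≤s))

mult-applyUpTo≤1 : ∀ (f : ℕ → ℕ) m n → (∀ {j j'} → f j ≡ f j' → j ≡ j') → mult (applyUpTo f m) n ≤ 1
mult-applyUpTo≤1 f zero n _ = z≤n
mult-applyUpTo≤1 f (suc m) n f-inj with f 0 ≟ n
... | yes refl = ≤-reflexive (cong₂ _+_ ([≡]-refl (f 0))
  (mult-applyUpTo-absent (f ∘ suc) m (λ _ → 1+n≢0 ∘ f-inj)))
... | no f0≢n = subst (_≤ 1) (cong (_+ mult (applyUpTo (f ∘ suc) m) n) (sym ([≡]-≢ f0≢n)))
  (mult-applyUpTo≤1 (f ∘ suc) m n (suc-injective ∘ f-inj))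

mult-applyUpTo>0⇒ : ∀ (f : ℕ → ℕ) m {n} → 0 < mult (applyUpTo f m) n → ∃[ j ] j < m × f j ≡ n
mult-applyUpTo>0⇒ f (suc m) {n} n∈ with f 0 ≟ n
... | yes f0≡n = 0 , s≤s z≤n , f0≡n
... | no f0≢n with mult-applyUpTo>0⇒ (f ∘ suc) m
  (subst (0 <_) (cong (_+ mult (applyUpTo (f ∘ suc) m) n) ([≡]-≢ f0≢n)) n∈)
... | j , j<m , fj≡n = suc j , s≤s j<m , fj≡n

mult-applyUpTo>0 : ∀ (f : ℕ → ℕ) {m j} → j < m → 0 < mult (applyUpTo f m) (f j)
mult-applyUpTo>0 f {suc m} {zero} _ = mult-head (f 0) (applyUpTo (f ∘ suc) m)
mult-applyUpTo>0 f {suc m} {suc j} (s≤s j<m) = ≤-trans (mult-applyUpTo>0 (f ∘ suc) j<m) (m≤n+m _ [ f 0 ≡ f (suc j) ])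

applyUpTo-+ : ∀ (f : ℕ → ℕ) k d → applyUpTo f (k + d) ≡ applyUpTo f k ++ applyUpTo (λ j → f (k + j)) d
applyUpTo-+ f zero d = refl
applyUpTo-+ f (suc k) d = cong (f 0 ∷_) (applyUpTo-+ (f ∘ suc) k d)

prefix-extends : ∀ w {k l} → k ≤ l → ∃[ e ] prefix w l ≡ prefix w k ++ e
prefix-extends w {k} k≤l = _ , trans (cong (prefix w) (sym (m+[n∸m]≡n k≤l))) (applyUpTo-+ _ k _)

∑-++-mono : ∀ f x e → ∑ f x ≤ ∑ f (x ++ e)
∑-++-mono f x e = subst (∑ f x ≤_) (sym (∑-++ f x e)) (m≤m+n _ _)

#≥-++-interval : ∀ {s t} → s ≤ t → ∀ x e → #≥ s x + #≥ t (x ++ e) ≤ #≥ s (x ++ e) + #≥ t x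
#≥-++-interval {s} {t} s≤t x e = begin
  #≥ s x + #≥ t (x ++ e)           ≡⟨ cong (#≥ s x +_) (∑-++ _ x e) ⟩
  #≥ s x + (#≥ t x + #≥ t e)       ≤⟨ +-monoʳ-≤ (#≥ s x) (+-monoʳ-≤ (#≥ t x) (#≥-antimonoˡ s≤t e)) ⟩
  #≥ s x + (#≥ t x + #≥ s e)       ≡⟨ x∙yz≈xz∙y (#≥ s x) (#≥ t x) (#≥ s e) ⟩
  #≥ s x + #≥ s e + #≥ t x         ≡⟨ cong (_+ #≥ t x) (∑-++ _ x e) ⟨
  #≥ s (x ++ e) + #≥ t x           ∎
  where open ≤-Reasoning

mult-prefix-mono : ∀ w {k l} → k ≤ l → ∀ n → mult (prefix w k) n ≤ mult (prefix w l) n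
mult-prefix-mono w {k} k≤l n with prefix-extends w k≤l
... | e , eq = subst (λ x → mult (prefix w k) n ≤ mult x n) (sym eq) (∑-++-mono _ (prefix w k) e)

#≥-prefix-mono : ∀ w {k l} → k ≤ l → ∀ t → #≥ t (prefix w k) ≤ #≥ t (prefix w l)
#≥-prefix-mono w {k} k≤l t with prefix-extends w k≤l
... | e , eq = subst (λ x → #≥ t (prefix w k) ≤ #≥ t x) (sym eq) (∑-++-mono _ (prefix w k) e)

#≥-prefix-interval : ∀ w {k l s t} → k ≤ l → s ≤ t →
  #≥ s (prefix w k) + #≥ t (prefix w l) ≤ #≥ s (prefix w l) + #≥ t (prefix w k)
#≥-prefix-interval w {k} {s = s} {t} k≤l s≤t with prefix-extends w k≤l
... | e , eq = subst (λ x → #≥ s (prefix w k) + #≥ t x ≤ #≥ s x + #≥ t (prefix w k)) (sym eq)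
  (#≥-++-interval s≤t (prefix w k) e)

-- Tail counts on intervals

#≥-interval-mono : ∀ α β {s t} → s ≤ t → (∀ n → s ≤ n → n < t → mult α n ≤ mult β n) →
  #≥ s α + #≥ t β ≤ #≥ s β + #≥ t α
#≥-interval-mono α β {s} {zero} z≤n _ = ≤-reflexive (+-comm (#≥ 0 α) (#≥ 0 β))
#≥-interval-mono α β {s} {suc t} s≤1+t α≤β with m≤n⇒m<n∨m≡n s≤1+t
... | inj₂ refl = ≤-reflexive (+-comm (#≥ s α) (#≥ s β))
... | inj₁ s<1+t = +-cancelˡ-≤ (mult β t) _ _ (begin
  mult β t + (#≥ s α + #≥ (suc t) β)    ≡⟨ x∙yz≈y∙xz (mult β t) (#≥ s α) _ ⟩
  #≥ s α + (mult β t + #≥ (suc t) β)    ≡⟨ cong (#≥ s α +_) (#≥-split t β) ⟨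
  #≥ s α + #≥ t β                       ≤⟨ #≥-interval-mono α β s≤t (λ n s≤n → α≤β n s≤n ∘ m<n⇒m<1+n) ⟩
  #≥ s β + #≥ t α                       ≡⟨ cong (#≥ s β +_) (#≥-split t α) ⟩
  #≥ s β + (mult α t + #≥ (suc t) α)    ≤⟨ +-monoʳ-≤ (#≥ s β) (+-monoˡ-≤ _ (α≤β t s≤t ≤-refl)) ⟩
  #≥ s β + (mult β t + #≥ (suc t) α)    ≡⟨ x∙yz≈y∙xz (#≥ s β) (mult β t) _ ⟩
  mult β t + (#≥ s β + #≥ (suc t) α)    ∎)
  where
  open ≤-Reasoning
  s≤t : s ≤ t
  s≤t = ≤-pred s<1+t

#≥-interval-≡ : ∀ α β {s t} → s ≤ t → (∀ n → s ≤ n → n < t → mult α n ≡ mult β n) →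
  #≥ s α + #≥ t β ≡ #≥ s β + #≥ t α
#≥-interval-≡ α β s≤t α≈β = ≤-antisym
  (#≥-interval-mono α β s≤t λ n s≤n n<t → ≤-reflexive (α≈β n s≤n n<t))
  (#≥-interval-mono β α s≤t λ n s≤n n<t → ≤-reflexive (sym (α≈β n s≤n n<t)))

#≥-vanishes : ∀ X {t} → ∑ suc X ≤ t → #≥ t X ≡ 0
#≥-vanishes [] _ = refl
#≥-vanishes (a ∷ X) {t} bound = cong₂ _+_ ([≤]-no (m+n≤o⇒m≤o (suc a) bound)) (#≥-vanishes X (m+n≤o⇒n≤o (suc a) bound))

#≥-agree-above : ∀ X Z {t} → (∀ n → t ≤ n → mult X n ≡ mult Z n) → #≥ t X ≡ #≥ t Z
#≥-agree-above X Z {t} X≈Z = +-cancelʳ-≡ 0 _ _ (begin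
  #≥ t X + 0        ≡⟨ cong (#≥ t X +_) (#≥-vanishes Z (≤-trans (m≤n+m _ (∑ suc X)) (m≤n+m _ t))) ⟨
  #≥ t X + #≥ T Z   ≡⟨ #≥-interval-≡ X Z t≤T (λ n t≤n _ → X≈Z n t≤n) ⟩
  #≥ t Z + #≥ T X   ≡⟨ cong (#≥ t Z +_) (#≥-vanishes X (≤-trans (m≤m+n _ (∑ suc Z)) (m≤n+m _ t))) ⟩
  #≥ t Z + 0        ∎)
  where
  open ≡-Reasoning
  T : ℕ
  T = t + (∑ suc X + ∑ suc Z)
  t≤T : t ≤ T
  t≤T = m≤m+n t _

NoneIn : (ℕ → Set) → ℕ → ℕ → Set
NoneIn P s t = ∀ n → s ≤ n → n < t → ¬ P n

least-in : ∀ {P : ℕ → Set} → Decidable P → ∀ s t →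
  NoneIn P s t ⊎ ∃[ y ] s ≤ y × y < t × P y × NoneIn P s y
least-in P? s zero = inj₁ λ _ _ ()
least-in P? s (suc t) with least-in P? s t
... | inj₂ (y , s≤y , y<t , Py , none) = inj₂ (y , s≤y , m≤n⇒m≤1+n y<t , Py , none)
... | inj₁ none with s ≤? t | P? t
...   | yes s≤t | yes Pt = inj₂ (t , s≤t , ≤-refl , Pt , none)
...   | yes _ | no ¬Pt = inj₁ λ n s≤n n≤t → case m≤n⇒m<n∨m≡n (≤-pred n≤t) of λ where
        (inj₁ n<t) → none n s≤n n<t
        (inj₂ refl) → ¬Pt
...   | no s≰t | _ = inj₁ λ n s≤n n≤t → ⊥-elim (s≰t (≤-trans s≤n (≤-pred n≤t)))

greatest-in : ∀ {P : ℕ → Set} → Decidable P → ∀ s t →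
  NoneIn P s t ⊎ ∃[ x ] s ≤ x × x < t × P x × NoneIn P (suc x) t
greatest-in P? s zero = inj₁ λ _ _ ()
greatest-in P? s (suc t) with s ≤? t | P? t
... | yes s≤t | yes Pt = inj₂ (t , s≤t , ≤-refl , Pt , λ n t<n n≤t → ⊥-elim (<⇒≱ t<n (≤-pred n≤t)))
... | no s≰t | _ = inj₁ λ n s≤n n≤t → ⊥-elim (s≰t (≤-trans s≤n (≤-pred n≤t)))
... | yes s≤t | no ¬Pt with greatest-in P? s t
...   | inj₂ (x , s≤x , x<t , Px , none) = inj₂ (x , s≤x , m≤n⇒m≤1+n x<t , Px , none′)
  where
  none′ : NoneIn _ (suc x) (suc t)
  none′ n x<n n≤t = case m≤n⇒m<n∨m≡n (≤-pred n≤t) of λ where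
    (inj₁ n<t) → none n x<n n<t
    (inj₂ refl) → ¬Pt
...   | inj₁ none = inj₁ λ n s≤n n≤t → case m≤n⇒m<n∨m≡n (≤-pred n≤t) of λ where
        (inj₁ n<t) → none n s≤n n<t
        (inj₂ refl) → ¬Pt

Surplus : List ℕ → List ℕ → ℕ → Set
Surplus α β n = mult β n < mult α n

surplus⇒∈∉ : ∀ {α β n} → IsPosSet α → Surplus α β n → n ∈ₘ α × n ∉ₘ β
surplus⇒∈∉ {α} {β} {n} S β<α = n∈α , n≤0⇒n≡0 (≤-pred (subst (mult β n <_) n∈α β<α))
  where
  n∈α : n ∈ₘ α
  n∈α = ≤-antisym (mult≤1 S n) (≤-trans (s≤s z≤n) β<α)

private
  no-surplus : ∀ α β {s t} → s ≤ t → NoneIn (Surplus α β) s t →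
    ¬ (#≥ s β + #≥ t α < #≥ s α + #≥ t β)
  no-surplus α β s≤t none = ≤⇒≯ (#≥-interval-mono α β s≤t λ n s≤n n<t → ≮⇒≥ (none n s≤n n<t))

first-surplus-above : ∀ {α β s} → IsPosSet α → #≥ s β < #≥ s α →
  ∃[ y ] s ≤ y × y ∈ₘ α × y ∉ₘ β × (∀ n → s ≤ n → n < y → mult α n ≤ mult β n)
first-surplus-above {α} {β} {s} S β<α = from-search (least-in (λ n → mult β n <? mult α n) s T)
  where
  T : ℕ
  T = s + (∑ suc α + ∑ suc β)
  more : #≥ s β + #≥ T α < #≥ s α + #≥ T β
  more = subst₂ (λ a b → #≥ s β + a < #≥ s α + b)
    (sym (#≥-vanishes α (≤-trans (m≤m+n _ (∑ suc β)) (m≤n+m _ s))))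
    (sym (#≥-vanishes β (≤-trans (m≤n+m _ (∑ suc α)) (m≤n+m _ s))))
    (+-monoˡ-< 0 β<α)
  from-search : NoneIn (Surplus α β) s T ⊎ ∃[ y ] s ≤ y × y < T × Surplus α β y × NoneIn (Surplus α β) s y →
    ∃[ y ] s ≤ y × y ∈ₘ α × y ∉ₘ β × (∀ n → s ≤ n → n < y → mult α n ≤ mult β n)
  from-search (inj₁ none) = ⊥-elim (no-surplus α β (m≤m+n s _) none more)
  from-search (inj₂ (y , s≤y , _ , β<α , none)) =
    let y∈α , y∉β = surplus⇒∈∉ {β = β} S β<α in
    y , s≤y , y∈α , y∉β , λ n s≤n n<y → ≮⇒≥ (none n s≤n n<y)

last-surplus : ∀ {α β s t} → IsPosSet α → s ≤ t → #≥ s β + #≥ t α < #≥ s α + #≥ t β →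
  ∃[ x ] s ≤ x × x < t × x ∈ₘ α × x ∉ₘ β × (∀ n → x < n → n < t → mult α n ≤ mult β n)
last-surplus {α} {β} {s} {t} S s≤t more with greatest-in (λ n → mult β n <? mult α n) s t
... | inj₁ none = ⊥-elim (no-surplus α β s≤t none more)
... | inj₂ (x , s≤x , x<t , β<α , none) =
  let x∈α , x∉β = surplus⇒∈∉ {β = β} S β<α in
  x , s≤x , x<t , x∈α , x∉β , λ n x<n n<t → ≮⇒≥ (none n x<n n<t)

shortfall-upward : ∀ w {k l α β s t} → k ≤ l → s ≤ t → α ≼ prefix w l → #≥ s α ≡ #≥ s (prefix w l) →
  suc (#≥ s β) ≤ #≥ s (prefix w k) → (∀ n → s ≤ n → n < t → mult α n ≤ mult β n) →
  suc (#≥ t β) ≤ #≥ t (prefix w k)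
shortfall-upward w {k} {l} {α} {β} {s} {t} k≤l s≤t α≼ α-full β-short α≤β = +-cancelˡ-≤ (#≥ s (prefix w l)) _ _ (begin
  #≥ s (prefix w l) + suc (#≥ t β)          ≡⟨ cong (_+ suc (#≥ t β)) α-full ⟨
  #≥ s α + suc (#≥ t β)                     ≡⟨ +-suc (#≥ s α) _ ⟩
  suc (#≥ s α + #≥ t β)                     ≤⟨ s≤s (#≥-interval-mono α β s≤t α≤β) ⟩
  suc (#≥ s β) + #≥ t α                     ≤⟨ +-mono-≤ β-short (α≼ t) ⟩
  #≥ s (prefix w k) + #≥ t (prefix w l)     ≤⟨ #≥-prefix-interval w k≤l s≤t ⟩
  #≥ s (prefix w l) + #≥ t (prefix w k)     ∎)
  where open ≤-Reasoning

shortfall-downward : ∀ w {k l α β t u} → k ≤ l → t ≤ u → β ≼ prefix w k → #≥ u β ≡ #≥ u (prefix w k) →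
  suc (#≥ u α) ≤ #≥ u (prefix w l) → (∀ n → t ≤ n → n < u → mult α n ≤ mult β n) →
  suc (#≥ t α) ≤ #≥ t (prefix w l)
shortfall-downward w {k} {l} {α} {β} {t} {u} k≤l t≤u β≼ β-full α-short α≤β = +-cancelʳ-≤ (#≥ u (prefix w k)) _ _ (begin
  suc (#≥ t α) + #≥ u (prefix w k)          ≡⟨ cong (suc (#≥ t α) +_) β-full ⟨
  suc (#≥ t α + #≥ u β)                     ≤⟨ s≤s (#≥-interval-mono α β t≤u α≤β) ⟩
  suc (#≥ t β + #≥ u α)                     ≡⟨ +-suc (#≥ t β) _ ⟨
  #≥ t β + suc (#≥ u α)                     ≤⟨ +-mono-≤ (β≼ t) α-short ⟩
  #≥ t (prefix w k) + #≥ u (prefix w l)     ≤⟨ #≥-prefix-interval w k≤l t≤u ⟩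
  #≥ t (prefix w l) + #≥ u (prefix w k)     ∎)
  where open ≤-Reasoning

-- Exchanging one element for another

remove : ℕ → List ℕ → List ℕ
remove y [] = []
remove y (a ∷ X) with a ≟ y
... | yes _ = remove y X
... | no _ = a ∷ remove y X

∑-remove : ∀ f y X → ∑ f (remove y X) + mult X y * f y ≡ ∑ f X
∑-remove f y [] = refl
∑-remove f y (a ∷ X) with a ≟ y
... | yes refl rewrite [≡]-refl a =
  trans (x∙yz≈y∙xz (∑ f (remove a X)) (f a) _) (cong (f a +_) (∑-remove f a X))
... | no a≢y rewrite [≡]-≢ a≢y = trans (+-assoc (f a) _ _) (cong (f a +_) (∑-remove f y X))

exch : ℕ → ℕ → List ℕ → List ℕ
exch x y X = sort (x ∷ remove y X)

∑-exch : ∀ f x y X → y ∈ₘ X → ∑ f (exch x y X) + f y ≡ ∑ f X + f x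
∑-exch f x y X y∈X = begin
  ∑ f (exch x y X) + f y                 ≡⟨ cong (_+ f y) (∑-sort f (x ∷ remove y X)) ⟩
  f x + ∑ f (remove y X) + f y           ≡⟨ +-assoc (f x) _ _ ⟩
  f x + (∑ f (remove y X) + f y)         ≡⟨ cong (λ m → f x + (∑ f (remove y X) + m)) (+-identityʳ (f y)) ⟨
  f x + (∑ f (remove y X) + 1 * f y)     ≡⟨ cong (λ m → f x + (∑ f (remove y X) + m * f y)) y∈X ⟨
  f x + (∑ f (remove y X) + mult X y * f y) ≡⟨ cong (f x +_) (∑-remove f y X) ⟩
  f x + ∑ f X                            ≡⟨ +-comm (f x) _ ⟩
  ∑ f X + f x                            ∎
  where open ≡-Reasoning

mult-exch : ∀ x y X → y ∈ₘ X → ∀ n → mult (exch x y X) n + [ y ≡ n ] ≡ mult X n + [ x ≡ n ]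
mult-exch x y X y∈X n = ∑-exch [_≡ n ] x y X y∈X

#≥-exch : ∀ x y X → y ∈ₘ X → ∀ t → #≥ t (exch x y X) + [ t ≤ y ] ≡ #≥ t X + [ t ≤ x ]
#≥-exch x y X y∈X t = ∑-exch [ t ≤_] x y X y∈X

exch-other : ∀ {x y X n} → y ∈ₘ X → n ≢ x → n ≢ y → mult (exch x y X) n ≡ mult X n
exch-other {x} {y} {X} {n} y∈X n≢x n≢y = +-cancelʳ-≡ 0 _ _ (begin
  mult (exch x y X) n + 0            ≡⟨ cong (mult (exch x y X) n +_) ([≡]-≢ (n≢y ∘ sym)) ⟨
  mult (exch x y X) n + [ y ≡ n ]    ≡⟨ mult-exch x y X y∈X n ⟩
  mult X n + [ x ≡ n ]               ≡⟨ cong (mult X n +_) ([≡]-≢ (n≢x ∘ sym)) ⟩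
  mult X n + 0                       ∎)
  where open ≡-Reasoning

exch-removes : ∀ {x y X} → x ≢ y → y ∈ₘ X → y ∉ₘ exch x y X
exch-removes {x} {y} {X} x≢y y∈X = +-cancelʳ-≡ 1 _ _ (begin
  mult (exch x y X) y + 1            ≡⟨ cong (mult (exch x y X) y +_) ([≡]-refl y) ⟨
  mult (exch x y X) y + [ y ≡ y ]    ≡⟨ mult-exch x y X y∈X y ⟩
  mult X y + [ x ≡ y ]               ≡⟨ cong₂ _+_ y∈X ([≡]-≢ x≢y) ⟩
  1                                  ∎)
  where open ≡-Reasoning

exch-IncSeq : ∀ {m x y X} → IncSeq m X → y ∈ₘ X → x ∉ₘ X → x ≢ 0 → IncSeq m (exch x y X)
exch-IncSeq {m} {x} {y} {X} X-inc y∈X x∉X x≢0 = IsPosSet⇒IncSeq length-exch (record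
  { sorted = sort-↗ _
  ; mult≤1 = mult≤1-exch
  ; 0∉ = n≤0⇒n≡0 (≤-trans (m≤m+n _ [ y ≡ 0 ])
      (≤-reflexive (trans (mult-exch x y X y∈X 0) (cong₂ _+_ (0∉ S) ([≡]-≢ x≢0))))) })
  where
  S : IsPosSet X
  S = IncSeq⇒IsPosSet X-inc
  length-exch : length (exch x y X) ≡ m
  length-exch = begin
    length (exch x y X)   ≡⟨ #≥0≡length (exch x y X) ⟨
    #≥ 0 (exch x y X)     ≡⟨ +-cancelʳ-≡ 1 _ _ (#≥-exch x y X y∈X 0) ⟩
    #≥ 0 X                ≡⟨ #≥0≡length X ⟩
    length X              ≡⟨ proj₁ X-inc ⟩
    m                     ∎
    where open ≡-Reasoning
  mult≤1-exch : ∀ n → mult (exch x y X) n ≤ 1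
  mult≤1-exch n with n ≟ x
  ... | yes refl = ≤-trans (m≤m+n _ [ y ≡ n ]) (≤-reflexive (trans (mult-exch x y X y∈X n) (cong₂ _+_ x∉X ([≡]-refl n))))
  ... | no n≢x = ≤-trans (m≤m+n _ [ y ≡ n ])
    (subst (_≤ 1) (sym (trans (mult-exch x y X y∈X n) (trans (cong (mult X n +_) ([≡]-≢ (n≢x ∘ sym))) (+-identityʳ _))))
      (mult≤1 S n))

exch-lower-≼ : ∀ {x y X} → x ≤ y → y ∈ₘ X → exch x y X ≼ X
exch-lower-≼ {x} {y} {X} x≤y y∈X t = +-cancelʳ-≤ [ t ≤ x ] _ _ (begin
  #≥ t (exch x y X) + [ t ≤ x ]  ≤⟨ +-monoʳ-≤ _ ([≤]-monoʳ t x≤y) ⟩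
  #≥ t (exch x y X) + [ t ≤ y ]  ≡⟨ #≥-exch x y X y∈X t ⟩
  #≥ t X + [ t ≤ x ]             ∎)
  where open ≤-Reasoning

private
  #≥-exch-unchanged : ∀ x y X → x ∈ₘ X → ∀ {t b} → [ t ≤ x ] ≡ b → [ t ≤ y ] ≡ b →
    #≥ t (exch y x X) ≡ #≥ t X
  #≥-exch-unchanged x y X x∈X {t} {b} tx ty =
    +-cancelʳ-≡ b _ _ (trans (cong (#≥ t (exch y x X) +_) (sym tx)) (trans (#≥-exch y x X x∈X t) (cong (#≥ t X +_) ty)))

exch-raise-≼ : ∀ {x y X Z} → x ≤ y → x ∈ₘ X → X ≼ Z →
  (∀ t → x < t → t ≤ y → suc (#≥ t X) ≤ #≥ t Z) → exch y x X ≼ Z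
exch-raise-≼ {x} {y} {X} {Z} x≤y x∈X X≼Z raised t with t ≤? x | t ≤? y
... | yes t≤x | _ = subst (_≤ #≥ t Z)
  (sym (#≥-exch-unchanged x y X x∈X {t} ([≤]-yes t≤x) ([≤]-yes (≤-trans t≤x x≤y)))) (X≼Z t)
... | no t≰x | no t≰y = subst (_≤ #≥ t Z)
  (sym (#≥-exch-unchanged x y X x∈X {t} ([≤]-no (≰⇒> t≰x)) ([≤]-no (≰⇒> t≰y)))) (X≼Z t)
... | no t≰x | yes t≤y = subst (_≤ #≥ t Z) (sym raised-by-one) (raised t (≰⇒> t≰x) t≤y)
  where
  raised-by-one : #≥ t (exch y x X) ≡ suc (#≥ t X)
  raised-by-one = trans (sym (+-identityʳ _)) (trans (cong (#≥ t (exch y x X) +_) (sym ([≤]-no (≰⇒> t≰x))))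
    (trans (#≥-exch y x X x∈X t) (trans (cong (#≥ t X +_) ([≤]-yes t≤y)) (+-comm _ 1))))

swap-⊕ : ∀ {x y α β} → y ∈ₘ α → x ∈ₘ β → α ⊕ β ≡ exch x y α ⊕ exch y x β
swap-⊕ {x} {y} {α} {β} y∈α x∈β = ↗-ext (sort-↗ _) (sort-↗ _) λ n → begin
  mult (α ⊕ β) n                     ≡⟨ mult-⊕ α β n ⟩
  mult α n + mult β n                ≡⟨ +-cancelʳ-≡ ([ x ≡ n ] + [ y ≡ n ]) _ _ (balance n) ⟩
  mult α′ n + mult β′ n              ≡⟨ mult-⊕ α′ β′ n ⟨
  mult (α′ ⊕ β′) n                   ∎
  where
  open ≡-Reasoning
  α′ β′ : List ℕ
  α′ = exch x y α
  β′ = exch y x β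
  balance : ∀ n → mult α n + mult β n + ([ x ≡ n ] + [ y ≡ n ]) ≡ mult α′ n + mult β′ n + ([ x ≡ n ] + [ y ≡ n ])
  balance n = begin
    mult α n + mult β n + ([ x ≡ n ] + [ y ≡ n ])       ≡⟨ interchange (mult α n) _ _ _ ⟩
    (mult α n + [ x ≡ n ]) + (mult β n + [ y ≡ n ])     ≡⟨ cong₂ _+_ (mult-exch x y α y∈α n) (mult-exch y x β x∈β n) ⟨
    (mult α′ n + [ y ≡ n ]) + (mult β′ n + [ x ≡ n ])   ≡⟨ interchange (mult α′ n) _ _ _ ⟩
    mult α′ n + mult β′ n + ([ y ≡ n ] + [ x ≡ n ])     ≡⟨ cong (mult α′ n + mult β′ n +_) (+-comm [ y ≡ n ] _) ⟩
    mult α′ n + mult β′ n + ([ x ≡ n ] + [ y ≡ n ])     ∎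

B-by-swap : ∀ {k l w α β x y} → x ≢ y → y ∈ₘ α → x ∈ₘ β →
  A l w α → A k w β → A l w (exch x y α) → A k w (exch y x β) →
  α ≢ exch y x β → β ≢ exch x y α → B k l w (α ⊕ β)
B-by-swap {α = α} {β} {x} {y} x≢y y∈α x∈β α∈A β∈A α′∈A β′∈A α≢β′ β≢α′ =
  α , exch x y α , β , exch y x β , α∈A , α′∈A , β∈A , β′∈A , refl , swap-⊕ {x} {y} {α} {β} y∈α x∈β ,
  ∈ₘ⇒≢∉ₘ y∈α (exch-removes {x} {y} {α} x≢y y∈α) , α≢β′ , β≢α′ ,
  ∈ₘ⇒≢∉ₘ x∈β (exch-removes {y} {x} {β} (x≢y ∘ sym) x∈β)

A≼-exch-lower : ∀ {m w x y α} → x ≤ y → y ∈ₘ α → x ∉ₘ α → x ≢ 0 → A≼ m w α → A≼ m w (exch x y α)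
A≼-exch-lower {x = x} {y} {α} x≤y y∈α x∉α x≢0 (α-inc , α≼) =
  exch-IncSeq α-inc y∈α x∉α x≢0 , λ t → ≤-trans (exch-lower-≼ {x} {y} {α} x≤y y∈α t) (α≼ t)

A≼-exch-raise : ∀ {m w x y α} → x ≤ y → x ∈ₘ α → y ∉ₘ α → y ≢ 0 → A≼ m w α →
  (∀ t → x < t → t ≤ y → suc (#≥ t α) ≤ #≥ t (prefix w m)) → A≼ m w (exch y x α)
A≼-exch-raise {m} {w} {x} {y} {α} x≤y x∈α y∉α y≢0 (α-inc , α≼) raised =
  exch-IncSeq α-inc x∈α y∉α y≢0 , exch-raise-≼ {x} {y} {α} {prefix w m} x≤y x∈α α≼ raised

-- Decompositions of α + s_i α

x+x≢1 : ∀ x → x + x ≢ 1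
x+x≢1 (suc x) e = 1+n≢0 (trans (sym (+-suc x x)) (suc-injective e))

private
  x+x-injective : ∀ {x a} → x + x ≡ a + a → x ≡ a
  x+x-injective {x} {a} e with <-cmp x a
  ... | tri< x<a _ _ = ⊥-elim (<⇒≢ (+-mono-< x<a x<a) e)
  ... | tri≈ _ x≡a _ = x≡a
  ... | tri> _ _ a<x = ⊥-elim (<⇒≢ (+-mono-< a<x a<x) (sym e))

  x+y≡a+a⇒x≡a : ∀ {x y a} → x ≤ 1 → y ≤ 1 → x + y ≡ a + a → x ≡ a
  x+y≡a+a⇒x≡a z≤n z≤n e = x+x-injective e
  x+y≡a+a⇒x≡a (s≤s z≤n) (s≤s z≤n) e = x+x-injective e
  x+y≡a+a⇒x≡a {a = a} z≤n (s≤s z≤n) e = ⊥-elim (x+x≢1 a (sym e))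
  x+y≡a+a⇒x≡a {a = a} (s≤s z≤n) z≤n e = ⊥-elim (x+x≢1 a (sym e))

halves-of-⊕-s : ∀ i {α X Y} → IsPosSet α → i ∈ₘ α → suc i ∉ₘ α → IsPosSet X → IsPosSet Y →
  length X ≡ length α → X ⊕ Y ≡ α ⊕ s[ i ]· α → X ≡ α ⊎ X ≡ s[ i ]· α
halves-of-⊕-s i {α} {X} {Y} Sα i∈α i+1∉α SX SY |X|≡|α| X⊕Y≡ = decide (n≤1⇒n≡0∨n≡1 (mult≤1 SX i))
  where
  agree : ∀ n → n ≢ i → n ≢ suc i → mult X n ≡ mult α n
  agree n n≢i n≢i+1 = x+y≡a+a⇒x≡a (mult≤1 SX n) (mult≤1 SY n) (begin
    mult X n + mult Y n           ≡⟨ mult-⊕ X Y n ⟨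
    mult (X ⊕ Y) n                ≡⟨ cong (λ η → mult η n) X⊕Y≡ ⟩
    mult (α ⊕ s[ i ]· α) n        ≡⟨ mult-⊕ α (s[ i ]· α) n ⟩
    mult α n + mult (s[ i ]· α) n ≡⟨ cong (mult α n +_) (trans (mult-s i α n) (cong (mult α) (tr-other i n≢i n≢i+1))) ⟩
    mult α n + mult α n           ∎)
    where open ≡-Reasoning
  one-of-two : mult X i + mult X (suc i) ≡ 1
  one-of-two = +-cancelʳ-≡ (#≥ (suc (suc i)) α) _ _ (+-cancelˡ-≡ (length α) _ _ (begin
    length α + (mult X i + mult X (suc i) + #≥ (suc (suc i)) α) ≡⟨ cong₂ _+_ (#≥0≡length α) (cong (mult X i + mult X (suc i) +_) above) ⟨
    #≥ 0 α + (mult X i + mult X (suc i) + #≥ (suc (suc i)) X)   ≡⟨ cong (#≥ 0 α +_) (#≥-split₂ i X) ⟨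
    #≥ 0 α + #≥ i X                                             ≡⟨ below ⟨
    #≥ 0 X + #≥ i α                                             ≡⟨ cong₂ _+_ (trans (#≥0≡length X) |X|≡|α|) (#≥-split₂ i α) ⟩
    length α + (mult α i + mult α (suc i) + #≥ (suc (suc i)) α) ≡⟨ cong (λ m → length α + (m + #≥ (suc (suc i)) α)) (cong₂ _+_ i∈α i+1∉α) ⟩
    length α + (1 + #≥ (suc (suc i)) α)                         ∎))
    where
    open ≡-Reasoning
    below : #≥ 0 X + #≥ i α ≡ #≥ 0 α + #≥ i X
    below = #≥-interval-≡ X α z≤n λ n _ n<i → agree n (<⇒≢ n<i) (<⇒≢ (m<n⇒m<1+n n<i))
    above : #≥ (suc (suc i)) X ≡ #≥ (suc (suc i)) α
    above = #≥-agree-above X α λ n i+2≤n →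
      agree n (>⇒≢ (≤-trans (n≤1+n (suc i)) i+2≤n)) (>⇒≢ i+2≤n)
  decide : i ∉ₘ X ⊎ i ∈ₘ X → X ≡ α ⊎ X ≡ s[ i ]· α
  decide (inj₂ i∈X) = inj₁ (↗-ext (sorted SX) (sorted Sα) λ n → case position i n of λ where
    (at-i refl) → trans i∈X (sym i∈α)
    (at-i+1 refl) → trans (+-cancelˡ-≡ 1 _ _ (trans (cong (_+ mult X (suc i)) (sym i∈X)) one-of-two)) (sym i+1∉α)
    (elsewhere n≢i n≢i+1) → agree n n≢i n≢i+1)
  decide (inj₁ i∉X) = inj₂ (↗-ext (sorted SX) (sort-↗ _) λ n → trans (agree′ n) (sym (mult-s i α n)))
    where
    agree′ : ∀ n → mult X n ≡ mult α (tr i n)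
    agree′ n with position i n
    ... | at-i refl = trans i∉X (sym (trans (cong (mult α) (tr-i i)) i+1∉α))
    ... | at-i+1 refl = trans (trans (cong (_+ mult X (suc i)) (sym i∉X)) one-of-two) (sym (trans (cong (mult α) (tr-i+1 i)) i∈α))
    ... | elsewhere n≢i n≢i+1 = trans (agree n n≢i n≢i+1) (cong (mult α) (sym (tr-other i n≢i n≢i+1)))

two-valued : ∀ {A : Set} {a b x y z : A} → x ≡ a ⊎ x ≡ b → y ≡ a ⊎ y ≡ b → z ≡ a ⊎ z ≡ b →
  z ≢ x → z ≢ y → x ≡ y
two-valued (inj₁ refl) (inj₁ refl) _ _ _ = refl
two-valued (inj₂ refl) (inj₂ refl) _ _ _ = refl
two-valued (inj₁ refl) (inj₂ refl) (inj₁ refl) z≢x _ = ⊥-elim (z≢x refl)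
two-valued (inj₁ refl) (inj₂ refl) (inj₂ refl) _ z≢y = ⊥-elim (z≢y refl)
two-valued (inj₂ refl) (inj₁ refl) (inj₁ refl) _ z≢y = ⊥-elim (z≢y refl)
two-valued (inj₂ refl) (inj₁ refl) (inj₂ refl) z≢x _ = ⊥-elim (z≢x refl)

-- A_m(s_i w) against A_m(w), and the sets B̃ and B

B-rebase : ∀ {k l u u′ η} (b : B k l u η) → let (α , α′ , β , β′ , _) = b in
  A l u′ α → A l u′ α′ → A k u′ β → A k u′ β′ → B k l u′ η
B-rebase (α , α′ , β , β′ , _ , _ , _ , _ , rest) α∈A α′∈A β∈A β′∈A =
  α , α′ , β , β′ , α∈A , α′∈A , β∈A , β′∈A , rest

module Ascent (w : FinPerm) (i : ℕ) .{{_ : NonZero i}} (i↗ : inv w i < inv w (suc i)) where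

  v : FinPerm
  v = s[ i ]∘ w

  L : ℕ → List ℕ
  L = prefix w

  G : ℕ → ℕ → ℕ
  G m t = #≥ t (L m)

  Aʷ Aᵛ : ℕ → List ℕ → Set
  Aʷ m = A≼ m w
  Aᵛ m = A≼ m v

  private
    <-≤1⇒0,1 : ∀ {m n} → m < n → n ≤ 1 → m ≡ 0 × n ≡ 1
    <-≤1⇒0,1 (s≤s z≤n) (s≤s z≤n) = refl , refl

    i≢i+1 : i ≢ suc i
    i≢i+1 = <⇒≢ ≤-refl

    i+2≢i+1 : suc (suc i) ≢ suc i
    i+2≢i+1 = 1+n≢n

    prefix-v : ∀ m → prefix v m ≡ map (tr i) (L m)
    prefix-v m = sym (map-applyUpTo _ (tr i) m)

  Gᵛ≡G : ∀ m {t} → t ≢ suc i → #≥ t (prefix v m) ≡ G m t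
  Gᵛ≡G m {t} t≢i+1 = trans (cong (#≥ t) (prefix-v m)) (#≥-map-tr i (L m) t≢i+1)

  Gᵛ-at-i+1 : ∀ m → #≥ (suc i) (prefix v m) ≡ G m (suc (suc i)) + mult (L m) i
  Gᵛ-at-i+1 m = trans (cong (#≥ (suc i)) (prefix-v m)) (#≥-map-tr-at-i+1 i (L m))

  mult-L≤1 : ∀ m n → mult (L m) n ≤ 1
  mult-L≤1 m n = mult-applyUpTo≤1 _ m n (suc-injective ∘ fun-injective w)

  -- The only use of the ascent w⁻¹(i) < w⁻¹(i+1).
  i+1∈L⇒i∈L : ∀ m → 0 < mult (L m) (suc i) → 0 < mult (L m) i
  i+1∈L⇒i∈L m i+1∈L with mult-applyUpTo>0⇒ _ m i+1∈L
  ... | j , j<m , w[j+1]≡i+1 = i∈L (inv w i) refl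
    where
    w[p]≡i : ∀ {p} → inv w i ≡ p → fun w p ≡ i
    w[p]≡i eq = trans (cong (fun w) (sym eq)) (fun-inv w i)
    i∈L : ∀ p → inv w i ≡ p → 0 < mult (L m) i
    i∈L zero eq = ⊥-elim (<⇒≢ (>-nonZero⁻¹ i) (trans (sym (fix0 w)) (w[p]≡i eq)))
    i∈L (suc p) eq = subst (λ n → 0 < mult (L m) n) (w[p]≡i eq) (mult-applyUpTo>0 _ (<-trans p<j j<m))
      where
      p<j : p < j
      p<j = ≤-pred (subst₂ _<_ eq (trans (cong (inv w) (sym w[j+1]≡i+1)) (inv-fun w (suc j))) i↗)

  mult-L-i+1≤i : ∀ m → mult (L m) (suc i) ≤ mult (L m) i
  mult-L-i+1≤i m with n≤1⇒n≡0∨n≡1 (mult-L≤1 m (suc i))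
  ... | inj₁ i+1∉L = subst (_≤ mult (L m) i) (sym i+1∉L) z≤n
  ... | inj₂ i+1∈L = subst (_≤ mult (L m) i) (sym i+1∈L) (i+1∈L⇒i∈L m (≤-reflexive (sym i+1∈L)))

  G≤Gᵛ : ∀ m t → G m t ≤ #≥ t (prefix v m)
  G≤Gᵛ m t with t ≟ suc i
  ... | no t≢i+1 = ≤-reflexive (sym (Gᵛ≡G m t≢i+1))
  ... | yes refl = begin
    G m (suc i)                                      ≡⟨ #≥-split (suc i) (L m) ⟩
    mult (L m) (suc i) + G m (suc (suc i))           ≤⟨ +-monoˡ-≤ _ (mult-L-i+1≤i m) ⟩
    mult (L m) i + G m (suc (suc i))                 ≡⟨ +-comm (mult (L m) i) _ ⟩
    G m (suc (suc i)) + mult (L m) i                 ≡⟨ Gᵛ-at-i+1 m ⟨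
    #≥ (suc i) (prefix v m)                          ∎
    where open ≤-Reasoning

  Aʷ⊆Aᵛ : ∀ {m α} → Aʷ m α → Aᵛ m α
  Aʷ⊆Aᵛ {m} (α-inc , α≼) = α-inc , λ t → ≤-trans (α≼ t) (G≤Gᵛ m t)

  Aᵛ-s : ∀ {m α} → Aᵛ m α → Aᵛ m (s[ i ]· α)
  Aᵛ-s {m} {α} (α-inc , α≼) = s-IncSeq i α-inc , bounded
    where
    bounded : ∀ t → #≥ t (s[ i ]· α) ≤ #≥ t (prefix v m)
    bounded t with t ≟ suc i
    ... | no t≢i+1 = subst (_≤ _) (sym (#≥-s i α t≢i+1)) (α≼ t)
    ... | yes refl = subst₂ _≤_ (sym (#≥-s-at-i+1 i α)) (sym (Gᵛ-at-i+1 m)) (bound-at-i+1 (n≤1⇒n≡0∨n≡1 (mult-L≤1 m i)))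
      where
      bound-at-i+1 : i ∉ₘ L m ⊎ i ∈ₘ L m → #≥ (suc (suc i)) α + mult α i ≤ G m (suc (suc i)) + mult (L m) i
      bound-at-i+1 (inj₂ i∈L) = +-mono-≤ (subst (_ ≤_) (Gᵛ≡G m i+2≢i+1) (α≼ (suc (suc i))))
        (subst (mult α i ≤_) (sym i∈L) (mult≤1 (IncSeq⇒IsPosSet α-inc) i))
      bound-at-i+1 (inj₁ i∉L) = begin
        #≥ (suc (suc i)) α + mult α i                      ≤⟨ +-monoʳ-≤ _ (m≤m+n (mult α i) (mult α (suc i))) ⟩
        #≥ (suc (suc i)) α + (mult α i + mult α (suc i))   ≡⟨ +-comm (#≥ (suc (suc i)) α) _ ⟩
        mult α i + mult α (suc i) + #≥ (suc (suc i)) α     ≡⟨ #≥-split₂ i α ⟨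
        #≥ i α                                             ≤⟨ subst (_ ≤_) (Gᵛ≡G m i≢i+1) (α≼ i) ⟩
        G m i                                              ≡⟨ #≥-split₂ i (L m) ⟩
        mult (L m) i + mult (L m) (suc i) + G m (suc (suc i)) ≡⟨ cong (λ c → c + G m (suc (suc i))) (cong₂ _+_ i∉L i+1∉L) ⟩
        G m (suc (suc i))                                  ≡⟨ +-identityʳ _ ⟨
        G m (suc (suc i)) + 0                              ≡⟨ cong (G m (suc (suc i)) +_) i∉L ⟨
        G m (suc (suc i)) + mult (L m) i                   ∎
        where
        open ≤-Reasoning
        i+1∉L : suc i ∉ₘ L m
        i+1∉L = n≤0⇒n≡0 (subst (mult (L m) (suc i) ≤_) i∉L (mult-L-i+1≤i m))

  Aᵛ⇒Aʷ : ∀ {m α} → Aᵛ m α → #≥ (suc i) α ≤ G m (suc i) → Aʷ m α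
  Aᵛ⇒Aʷ {m} {α} (α-inc , α≼) ok = α-inc , bounded
    where
    bounded : α ≼ L m
    bounded t with t ≟ suc i
    ... | yes refl = ok
    ... | no t≢i+1 = subst (_ ≤_) (Gᵛ≡G m t≢i+1) (α≼ t)

  Aʷ? : ∀ {m α} → Aᵛ m α → Dec (Aʷ m α)
  Aʷ? {m} {α} α∈Aᵛ with #≥ (suc i) α ≤? G m (suc i)
  ... | yes ok = yes (Aᵛ⇒Aʷ α∈Aᵛ ok)
  ... | no ¬ok = no λ α∈Aʷ → ¬ok (proj₂ α∈Aʷ (suc i))

  record Critical (m : ℕ) (α : List ℕ) : Set where
    field
      i∈α : i ∈ₘ α
      i+1∉α : suc i ∉ₘ α
      i∈L : i ∈ₘ L m
      i+1∉L : suc i ∉ₘ L m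
      tight : #≥ (suc i) α ≡ G m (suc i)

  critical : ∀ {m α} → Aʷ m α → ¬ Aʷ m (s[ i ]· α) → Critical m α
  critical {m} {α} α∈Aʷ sα∉Aʷ = record
    { i∈α = proj₂ a′<a ; i+1∉α = proj₁ a′<a ; i∈L = proj₂ c′<c ; i+1∉L = proj₁ c′<c
    ; tight = trans (#≥-split (suc i) α) (trans (cong (_+ g) (proj₁ a′<a)) (sym tight)) }
    where
    g G₂ : ℕ
    g = #≥ (suc (suc i)) α
    G₂ = G m (suc (suc i))
    sα∈Aᵛ : Aᵛ m (s[ i ]· α)
    sα∈Aᵛ = Aᵛ-s (Aʷ⊆Aᵛ α∈Aʷ)
    fails : G m (suc i) < g + mult α i
    fails = subst (G m (suc i) <_) (#≥-s-at-i+1 i α) (≰⇒> λ ok → sα∉Aʷ (Aᵛ⇒Aʷ sα∈Aᵛ ok))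
    holds : mult α (suc i) + g ≤ G m (suc i)
    holds = subst (_≤ G m (suc i)) (#≥-split (suc i) α) (proj₂ α∈Aʷ (suc i))
    a′<a : mult α (suc i) ≡ 0 × mult α i ≡ 1
    a′<a = <-≤1⇒0,1 (+-cancelʳ-< g _ _ (≤-<-trans holds (subst (G m (suc i) <_) (+-comm g _) fails)))
                     (mult≤1 (IncSeq⇒IsPosSet (proj₁ α∈Aʷ)) i)
    tight : G m (suc i) ≡ g
    tight = ≤-antisym (≤-pred (subst (G m (suc i) <_) (trans (cong (g +_) (proj₂ a′<a)) (+-comm g 1)) fails))
                      (≤-trans (m≤n+m g _) holds)
    c′<c : mult (L m) (suc i) ≡ 0 × mult (L m) i ≡ 1
    c′<c = <-≤1⇒0,1 (+-cancelʳ-< G₂ _ _ (begin-strict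
      mult (L m) (suc i) + G₂   ≡⟨ #≥-split (suc i) (L m) ⟨
      G m (suc i)               <⟨ fails ⟩
      g + mult α i              ≡⟨ #≥-s-at-i+1 i α ⟨
      #≥ (suc i) (s[ i ]· α)    ≤⟨ proj₂ sα∈Aᵛ (suc i) ⟩
      #≥ (suc i) (prefix v m)   ≡⟨ Gᵛ-at-i+1 m ⟩
      G₂ + mult (L m) i         ≡⟨ +-comm G₂ _ ⟩
      mult (L m) i + G₂         ∎))
      (mult-L≤1 m i)
      where open ≤-Reasoning

  critical-full-at-i : ∀ {m α} → Critical m α → #≥ i α ≡ G m i
  critical-full-at-i {m} {α} crit = begin
    #≥ i α                           ≡⟨ #≥-split i α ⟩
    mult α i + #≥ (suc i) α          ≡⟨ cong₂ _+_ (trans i∈α (sym i∈L)) tight ⟩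
    mult (L m) i + G m (suc i)       ≡⟨ #≥-split i (L m) ⟨
    G m i                            ∎
    where
    open ≡-Reasoning
    open Critical crit

  critical-full-at-i+2 : ∀ {m α} → Critical m α → #≥ (suc (suc i)) α ≡ G m (suc (suc i))
  critical-full-at-i+2 {m} {α} crit = begin
    #≥ (suc (suc i)) α                       ≡⟨ cong (_+ #≥ (suc (suc i)) α) i+1∉α ⟨
    mult α (suc i) + #≥ (suc (suc i)) α      ≡⟨ #≥-split (suc i) α ⟨
    #≥ (suc i) α                             ≡⟨ tight ⟩
    G m (suc i)                              ≡⟨ #≥-split (suc i) (L m) ⟩
    mult (L m) (suc i) + G m (suc (suc i))   ≡⟨ cong (_+ G m (suc (suc i))) i+1∉L ⟩
    G m (suc (suc i))                        ∎
    where
    open ≡-Reasoning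
    open Critical crit

  Aʷ-full-at-0 : ∀ {m α} → Aʷ m α → #≥ 0 α ≡ G m 0
  Aʷ-full-at-0 {m} {α} ((|α|≡m , _) , _) = begin
    #≥ 0 α       ≡⟨ #≥0≡length α ⟩
    length α     ≡⟨ |α|≡m ⟩
    m            ≡⟨ length-applyUpTo _ m ⟨
    length (L m) ≡⟨ #≥0≡length (L m) ⟨
    G m 0        ∎
    where open ≡-Reasoning

  record Fresh (m : ℕ) (α : List ℕ) : Set where
    field
      i∉α : i ∉ₘ α
      i+1∈α : suc i ∈ₘ α
      sα∈Aʷ : Aʷ m (s[ i ]· α)

  fresh : ∀ {m α} → Aᵛ m α → ¬ Aʷ m α → Fresh m α
  fresh {m} {α} α∈Aᵛ α∉Aʷ = record { i∉α = a≡0 ; i+1∈α = proj₂ c′<a′ ; sα∈Aʷ = image∈Aʷ }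
    where
    g G₂ : ℕ
    g = #≥ (suc (suc i)) α
    G₂ = G m (suc (suc i))
    fails : mult (L m) (suc i) + G₂ < mult α (suc i) + g
    fails = subst₂ _<_ (#≥-split (suc i) (L m)) (#≥-split (suc i) α) (≰⇒> λ ok → α∉Aʷ (Aᵛ⇒Aʷ α∈Aᵛ ok))
    above : g ≤ G₂
    above = subst (g ≤_) (Gᵛ≡G m i+2≢i+1) (proj₂ α∈Aᵛ (suc (suc i)))
    c′<a′ : mult (L m) (suc i) ≡ 0 × mult α (suc i) ≡ 1
    c′<a′ = <-≤1⇒0,1 (+-cancelʳ-< G₂ _ _ (<-≤-trans fails (+-monoʳ-≤ _ above)))
                      (mult≤1 (IncSeq⇒IsPosSet (proj₁ α∈Aᵛ)) (suc i))
    g≡G₂ : g ≡ G₂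
    g≡G₂ = ≤-antisym above (≤-pred (subst₂ _<_ (cong (_+ G₂) (proj₁ c′<a′)) (cong (_+ g) (proj₂ c′<a′)) fails))
    a≡0 : i ∉ₘ α
    a≡0 = n≤0⇒n≡0 (+-cancelʳ-≤ (1 + g) _ 0 (begin
      mult α i + (1 + g)                         ≡⟨ cong (λ a′ → mult α i + (a′ + g)) (proj₂ c′<a′) ⟨
      mult α i + (mult α (suc i) + g)            ≡⟨ +-assoc (mult α i) _ _ ⟨
      mult α i + mult α (suc i) + g              ≡⟨ #≥-split₂ i α ⟨
      #≥ i α                                     ≤⟨ subst (_ ≤_) (Gᵛ≡G m i≢i+1) (proj₂ α∈Aᵛ i) ⟩
      G m i                                      ≡⟨ #≥-split₂ i (L m) ⟩
      mult (L m) i + mult (L m) (suc i) + G₂     ≡⟨ cong₂ (λ c′ G → mult (L m) i + c′ + G) (proj₁ c′<a′) (sym g≡G₂) ⟩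
      mult (L m) i + 0 + g                       ≤⟨ +-monoˡ-≤ g (≤-trans (≤-reflexive (+-identityʳ _)) (mult-L≤1 m i)) ⟩
      1 + g                                      ∎))
      where open ≤-Reasoning
    image∈Aʷ : Aʷ m (s[ i ]· α)
    image∈Aʷ = Aᵛ⇒Aʷ (Aᵛ-s α∈Aᵛ) (≤-reflexive (begin
      #≥ (suc i) (s[ i ]· α)      ≡⟨ #≥-s-at-i+1 i α ⟩
      g + mult α i                ≡⟨ cong (g +_) a≡0 ⟩
      g + 0                       ≡⟨ +-identityʳ g ⟩
      g                           ≡⟨ g≡G₂ ⟩
      G₂                          ≡⟨ cong (_+ G₂) (proj₁ c′<a′) ⟨
      mult (L m) (suc i) + G₂     ≡⟨ #≥-split (suc i) (L m) ⟨
      G m (suc i)                 ∎))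
      where open ≡-Reasoning

  toA : ∀ {m α} → Aʷ m α → A m w α
  toA = A≼⇒A {w = w}

  fromA : ∀ {m α} → A m w α → Aʷ m α
  fromA = A⇒A≼ {w = w}

  toAᵛ : ∀ {m α} → Aᵛ m α → A m v α
  toAᵛ = A≼⇒A {w = v}

  fromAᵛ : ∀ {m α} → A m v α → Aᵛ m α
  fromAᵛ = A⇒A≼ {w = v}

  -- Trade i+1 ∈ β for the least y > i+1 in α ∖ β; minimality of y keeps the raised β below w^k.
  exchange-above : ∀ {k l α β} → k ≤ l → Aʷ l α → Critical l α → Aʷ k β → i ∉ₘ β → suc i ∈ₘ β →
    B k l w (α ⊕ β)
  exchange-above {k} {l} {α} {β} k≤l α∈Aʷ crit β∈Aʷ i∉β i+1∈β = swap (first-surplus-above {α} {β} Sα β<α)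
    where
    open Critical crit
    s : ℕ
    s = suc (suc i)
    Sα : IsPosSet α
    Sα = IncSeq⇒IsPosSet (proj₁ α∈Aʷ)
    i+1∉Lk : suc i ∉ₘ L k
    i+1∉Lk = n≤0⇒n≡0 (subst (mult (L k) (suc i) ≤_) i+1∉L (mult-prefix-mono w k≤l (suc i)))
    β-short : suc (#≥ s β) ≤ G k s
    β-short = subst₂ _≤_ (trans (#≥-split (suc i) β) (cong (_+ #≥ s β) i+1∈β))
                         (trans (#≥-split (suc i) (L k)) (cong (_+ G k s) i+1∉Lk)) (proj₂ β∈Aʷ (suc i))
    α-full : #≥ s α ≡ G l s
    α-full = critical-full-at-i+2 crit
    β<α : #≥ s β < #≥ s α
    β<α = ≤-trans β-short (≤-trans (#≥-prefix-mono w k≤l s) (≤-reflexive (sym α-full)))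
    swap : ∃[ y ] s ≤ y × y ∈ₘ α × y ∉ₘ β × (∀ n → s ≤ n → n < y → mult α n ≤ mult β n) → B k l w (α ⊕ β)
    swap (y , s≤y , y∈α , y∉β , α≤β) = B-by-swap {k} {l} {w} {α} {β} {suc i} {y} i+1≢y y∈α i+1∈β
      (toA α∈Aʷ) (toA β∈Aʷ) (toA α′∈Aʷ) (toA β′∈Aʷ)
      (∈ₘ⇒≢∉ₘ i∈α (trans (exch-other {y} {suc i} {β} i+1∈β i≢y i≢i+1) i∉β))
      (≢-sym (∈ₘ⇒≢∉ₘ (trans (exch-other {suc i} {y} {α} y∈α i≢i+1 i≢y) i∈α) i∉β))
      where
      i+1≤y : suc i ≤ y
      i+1≤y = ≤-trans (n≤1+n (suc i)) s≤y
      i+1≢y : suc i ≢ y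
      i+1≢y = <⇒≢ s≤y
      i≢y : i ≢ y
      i≢y = <⇒≢ (<-trans ≤-refl s≤y)
      α′∈Aʷ : Aʷ l (exch (suc i) y α)
      α′∈Aʷ = A≼-exch-lower {w = w} i+1≤y y∈α i+1∉α (λ ()) α∈Aʷ
      raised : ∀ t → suc i < t → t ≤ y → suc (#≥ t β) ≤ G k t
      raised t s≤t t≤y = shortfall-upward w {α = α} {β} k≤l s≤t (proj₂ α∈Aʷ) α-full β-short
        λ n s≤n n<t → α≤β n s≤n (<-≤-trans n<t t≤y)
      β′∈Aʷ : Aʷ k (exch y (suc i) β)
      β′∈Aʷ = A≼-exch-raise {w = w} i+1≤y i+1∈β y∉β (m<n⇒n≢0 s≤y) β∈Aʷ raised

  -- Trade i ∈ β for the largest x < i in α ∖ β; maximality of x keeps the raised α below w^l.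
  exchange-below : ∀ {k l α β} → k ≤ l → Aʷ l α → i ∉ₘ α → suc i ∈ₘ α → Aʷ k β → Critical k β →
    B k l w (α ⊕ β)
  exchange-below {k} {l} {α} {β} k≤l α∈Aʷ i∉α i+1∈α β∈Aʷ crit = swap (last-surplus {α} {β} Sα z≤n more)
    where
    open Critical crit renaming (i∈α to i∈β; i+1∉α to i+1∉β)
    Sα : IsPosSet α
    Sα = IncSeq⇒IsPosSet (proj₁ α∈Aʷ)
    β-full : #≥ i β ≡ G k i
    β-full = critical-full-at-i crit
    α-short : suc (#≥ i α) ≤ G l i
    α-short = begin
      suc (#≥ i α)                     ≡⟨ cong suc (trans (#≥-split i α) (cong (_+ #≥ (suc i) α) i∉α)) ⟩
      suc (#≥ (suc i) α)               ≤⟨ +-mono-≤ (subst (_≤ mult (L l) i) i∈L (mult-prefix-mono w k≤l i)) (proj₂ α∈Aʷ (suc i)) ⟩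
      mult (L l) i + G l (suc i)       ≡⟨ #≥-split i (L l) ⟨
      G l i                            ∎
      where open ≤-Reasoning
    more : #≥ 0 β + #≥ i α < #≥ 0 α + #≥ i β
    more = begin-strict
      #≥ 0 β + #≥ i α    <⟨ +-mono-≤-< (proj₂ β∈Aʷ 0) α-short ⟩
      G k 0 + G l i      ≤⟨ #≥-prefix-interval w k≤l (z≤n {i}) ⟩
      G l 0 + G k i      ≡⟨ cong₂ _+_ (sym (Aʷ-full-at-0 α∈Aʷ)) (sym β-full) ⟩
      #≥ 0 α + #≥ i β    ∎
      where open ≤-Reasoning
    swap : ∃[ x ] 0 ≤ x × x < i × x ∈ₘ α × x ∉ₘ β × (∀ n → x < n → n < i → mult α n ≤ mult β n) → B k l w (α ⊕ β)
    swap (x , _ , x<i , x∈α , x∉β , α≤β) = B-by-swap {k} {l} {w} {α} {β} {i} {x} (>⇒≢ x<i) x∈α i∈β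
      (toA α∈Aʷ) (toA β∈Aʷ) (toA α′∈Aʷ) (toA β′∈Aʷ)
      (∈ₘ⇒≢∉ₘ i+1∈α (trans (exch-other {x} {i} {β} i∈β (>⇒≢ (<-trans x<i ≤-refl)) (≢-sym i≢i+1)) i+1∉β))
      (≢-sym (∈ₘ⇒≢∉ₘ (trans (exch-other {i} {x} {α} x∈α (≢-sym i≢i+1) (>⇒≢ (<-trans x<i ≤-refl))) i+1∈α) i+1∉β))
      where
      x≤i : x ≤ i
      x≤i = <⇒≤ x<i
      x≢0 : x ≢ 0
      x≢0 refl = 1+n≢0 (trans (sym x∈α) (0∉ Sα))
      raised : ∀ t → x < t → t ≤ i → suc (#≥ t α) ≤ G l t
      raised t x<t t≤i = shortfall-downward w {α = α} {β} k≤l t≤i (proj₂ β∈Aʷ) β-full α-short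
        λ n t≤n n<i → α≤β n (<-≤-trans x<t t≤n) n<i
      α′∈Aʷ : Aʷ l (exch i x α)
      α′∈Aʷ = A≼-exch-raise {w = w} x≤i x∈α i∉α (>⇒≢ (>-nonZero⁻¹ i)) α∈Aʷ raised
      β′∈Aʷ : Aʷ k (exch x i β)
      β′∈Aʷ = A≼-exch-lower {w = w} x≤i i∈β x∉β x≢0 β∈Aʷ

  Ai⇒Critical : ∀ {m α} → Ai m i w α → Critical m α
  Ai⇒Critical (α∈A , sα∉A) = critical (fromA α∈A) (sα∉A ∘ toA)

  critical⇒Ai : ∀ {m α} → Aʷ m α → ¬ Aʷ m (s[ i ]· α) → Ai m i w α
  critical⇒Ai α∈Aʷ sα∉Aʷ = toA α∈Aʷ , sα∉Aʷ ∘ fromA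

  fresh⇒Ai : ∀ {m α} → Aᵛ m α → ¬ Aʷ m α → Ai m i w (s[ i ]· α)
  fresh⇒Ai {m} α∈Aᵛ α∉Aʷ = toA (Fresh.sα∈Aʷ (fresh α∈Aᵛ α∉Aʷ)) ,
    λ ssα∈A → α∉Aʷ (fromA (subst (A m w) (s-involutive i (IncSeq⇒sorted (proj₁ α∈Aᵛ))) ssα∈A))

  s-image-in-Aʷ : ∀ {m α} → Aᵛ m α → ¬ Aʷ m (s[ i ]· α) → Aʷ m α
  s-image-in-Aʷ α∈Aᵛ sα∉Aʷ with Aʷ? α∈Aᵛ
  ... | yes α∈Aʷ = α∈Aʷ
  ... | no α∉Aʷ = ⊥-elim (sα∉Aʷ (Fresh.sα∈Aʷ (fresh α∈Aᵛ α∉Aʷ)))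

  data Placement (m : ℕ) (α : List ℕ) : Set where
    both-in : Aʷ m α → Aʷ m (s[ i ]· α) → Placement m α
    only-α-in : Aʷ m α → ¬ Aʷ m (s[ i ]· α) → Placement m α
    only-sα-in : ¬ Aʷ m α → Aʷ m (s[ i ]· α) → Placement m α

  placement : ∀ {m α} → Aᵛ m α → Placement m α
  placement α∈Aᵛ with Aʷ? α∈Aᵛ | Aʷ? (Aᵛ-s α∈Aᵛ)
  ... | yes α∈Aʷ | yes sα∈Aʷ = both-in α∈Aʷ sα∈Aʷ
  ... | yes α∈Aʷ | no sα∉Aʷ = only-α-in α∈Aʷ sα∉Aʷ
  ... | no α∉Aʷ | _ = only-sα-in α∉Aʷ (Fresh.sα∈Aʷ (fresh α∈Aᵛ α∉Aʷ))

  Sums : ℕ → ℕ → List ℕ → Set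
  Sums k l η = ∃[ α ] ∃[ β ] Ai l i w α × Ai k i w β × η ≡ α ⊕ s[ i ]· β

  Diagonal : ℕ → List ℕ → Set
  Diagonal l η = ∃[ α ] Ai l i w α × η ≡ α ⊕ s[ i ]· α

  B̃ʷ∪sB̃ʷ∪Sums : ℕ → ℕ → List ℕ → Set
  B̃ʷ∪sB̃ʷ∪Sums k l η = B̃ k l w η ⊎ (∃[ η′ ] B̃ k l w η′ × η ≡ s[ i ]· η′) ⊎ Sums k l η

  B̃ᵛ⇒ : ∀ {k l η} → B̃ k l v η → B̃ʷ∪sB̃ʷ∪Sums k l η
  B̃ᵛ⇒ {k} {l} (α , β , α∈A , β∈A , refl) = by (placement α∈Aᵛ) (placement β∈Aᵛ)
    where
    α∈Aᵛ : Aᵛ l α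
    α∈Aᵛ = fromAᵛ α∈A
    β∈Aᵛ : Aᵛ k β
    β∈Aᵛ = fromAᵛ β∈A
    in-w : Aʷ l α → Aʷ k β → B̃ʷ∪sB̃ʷ∪Sums k l (α ⊕ β)
    in-w α∈Aʷ β∈Aʷ = inj₁ (α , β , toA α∈Aʷ , toA β∈Aʷ , refl)
    images-in-w : Aʷ l (s[ i ]· α) → Aʷ k (s[ i ]· β) → B̃ʷ∪sB̃ʷ∪Sums k l (α ⊕ β)
    images-in-w sα∈Aʷ sβ∈Aʷ = inj₂ (inj₁ (_ , (_ , _ , toA sα∈Aʷ , toA sβ∈Aʷ , refl) ,
      sym (trans (s-⊕ i _ _) (cong₂ _⊕_ (s-involutive i (IncSeq⇒sorted (proj₁ α∈A)))
                                          (s-involutive i (IncSeq⇒sorted (proj₁ β∈A)))))))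
    by : Placement l α → Placement k β → B̃ʷ∪sB̃ʷ∪Sums k l (α ⊕ β)
    by (both-in α∈Aʷ _) (both-in β∈Aʷ _) = in-w α∈Aʷ β∈Aʷ
    by (both-in α∈Aʷ _) (only-α-in β∈Aʷ _) = in-w α∈Aʷ β∈Aʷ
    by (only-α-in α∈Aʷ _) (both-in β∈Aʷ _) = in-w α∈Aʷ β∈Aʷ
    by (only-α-in α∈Aʷ _) (only-α-in β∈Aʷ _) = in-w α∈Aʷ β∈Aʷ
    by (both-in _ sα∈Aʷ) (only-sα-in _ sβ∈Aʷ) = images-in-w sα∈Aʷ sβ∈Aʷ
    by (only-sα-in _ sα∈Aʷ) (both-in _ sβ∈Aʷ) = images-in-w sα∈Aʷ sβ∈Aʷ
    by (only-sα-in _ sα∈Aʷ) (only-sα-in _ sβ∈Aʷ) = images-in-w sα∈Aʷ sβ∈Aʷ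
    by (only-α-in α∈Aʷ sα∉Aʷ) (only-sα-in β∉Aʷ _) = inj₂ (inj₂ (α , s[ i ]· β , critical⇒Ai α∈Aʷ sα∉Aʷ ,
      fresh⇒Ai β∈Aᵛ β∉Aʷ , cong (α ⊕_) (sym (s-involutive i (IncSeq⇒sorted (proj₁ β∈A))))))
    by (only-sα-in α∉Aʷ _) (only-α-in β∈Aʷ sβ∉Aʷ) = inj₂ (inj₂ (s[ i ]· α , β , fresh⇒Ai α∈Aᵛ α∉Aʷ ,
      critical⇒Ai β∈Aʷ sβ∉Aʷ , trans (sym (s-fixes-opposites i {α} {β} i∉α i+1∈α i∈β i+1∉β)) (s-⊕ i α β)))
      where
      open Fresh (fresh α∈Aᵛ α∉Aʷ) using () renaming (i∉α to i∉α; i+1∈α to i+1∈α)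
      open Critical (critical β∈Aʷ sβ∉Aʷ) using () renaming (i∈α to i∈β; i+1∉α to i+1∉β)

  ⇒B̃ᵛ : ∀ {k l η} → B̃ʷ∪sB̃ʷ∪Sums k l η → B̃ k l v η
  ⇒B̃ᵛ (inj₁ (α , β , α∈A , β∈A , η≡)) = α , β , toAᵛ (Aʷ⊆Aᵛ (fromA α∈A)) , toAᵛ (Aʷ⊆Aᵛ (fromA β∈A)) , η≡
  ⇒B̃ᵛ (inj₂ (inj₁ (_ , (α , β , α∈A , β∈A , refl) , refl))) =
    s[ i ]· α , s[ i ]· β , toAᵛ (Aᵛ-s (Aʷ⊆Aᵛ (fromA α∈A))) , toAᵛ (Aᵛ-s (Aʷ⊆Aᵛ (fromA β∈A))) , s-⊕ i α β
  ⇒B̃ᵛ (inj₂ (inj₂ (α , β , (α∈A , _) , (β∈A , _) , η≡))) =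
    α , s[ i ]· β , toAᵛ (Aʷ⊆Aᵛ (fromA α∈A)) , toAᵛ (Aᵛ-s (Aʷ⊆Aᵛ (fromA β∈A))) , η≡

  B̃ᵛ-s : ∀ {k l η} → B̃ k l v η → B̃ k l v (s[ i ]· η)
  B̃ᵛ-s (α , β , α∈A , β∈A , refl) =
    s[ i ]· α , s[ i ]· β , toAᵛ (Aᵛ-s (fromAᵛ α∈A)) , toAᵛ (Aᵛ-s (fromAᵛ β∈A)) , s-⊕ i α β

  Bᵛ-s : ∀ {k l η} → B k l v η → B k l v (s[ i ]· η)
  Bᵛ-s (α , α′ , β , β′ , α∈A , α′∈A , β∈A , β′∈A , refl , η≡ , α≢α′ , α≢β′ , β≢α′ , β≢β′) =
    s[ i ]· α , s[ i ]· α′ , s[ i ]· β , s[ i ]· β′ ,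
    toAᵛ (Aᵛ-s (fromAᵛ α∈A)) , toAᵛ (Aᵛ-s (fromAᵛ α′∈A)) , toAᵛ (Aᵛ-s (fromAᵛ β∈A)) , toAᵛ (Aᵛ-s (fromAᵛ β′∈A)) ,
    s-⊕ i α β , trans (cong s[ i ]· η≡) (s-⊕ i α′ β′) ,
    α≢α′ ∘ s-injective i (IncSeq⇒sorted (proj₁ α∈A)) (IncSeq⇒sorted (proj₁ α′∈A)) ,
    α≢β′ ∘ s-injective i (IncSeq⇒sorted (proj₁ α∈A)) (IncSeq⇒sorted (proj₁ β′∈A)) ,
    β≢α′ ∘ s-injective i (IncSeq⇒sorted (proj₁ β∈A)) (IncSeq⇒sorted (proj₁ α′∈A)) ,
    β≢β′ ∘ s-injective i (IncSeq⇒sorted (proj₁ β∈A)) (IncSeq⇒sorted (proj₁ β′∈A))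

  Bʷ⊆Bᵛ : ∀ {k l η} → B k l w η → B k l v η
  Bʷ⊆Bᵛ η∈Bʷ@(_ , _ , _ , _ , α∈A , α′∈A , β∈A , β′∈A , _) =
    B-rebase {u = w} {u′ = v} η∈Bʷ (widen α∈A) (widen α′∈A) (widen β∈A) (widen β′∈A)
    where
    widen : ∀ {m γ} → A m w γ → A m v γ
    widen = toAᵛ ∘ Aʷ⊆Aᵛ ∘ fromA

  -- α, β and α′ are each γ or s_i γ, and α′ differs from the other two, so α = β and the
  -- multiplicity of i in η = γ + s_i γ would be even.
  off-diagonal : ∀ {k l η} → B k l v η → k ≡ l → ¬ Diagonal l η
  off-diagonal {l = l} (α , α′ , β , β′ , α∈A , α′∈A , β∈A , β′∈A , refl , η≡ , α≢α′ , _ , β≢α′ , _) refl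
               (γ , γ∈Ai , η≡γ⊕sγ) =
    x+x≢1 (mult α i) (begin
      mult α i + mult α i     ≡⟨ cong (λ δ → mult α i + mult δ i) α≡β ⟩
      mult α i + mult β i     ≡⟨ mult-⊕ α β i ⟨
      mult (α ⊕ β) i          ≡⟨ cong (λ η → mult η i) η≡γ⊕sγ ⟩
      mult (γ ⊕ s[ i ]· γ) i  ≡⟨ mult-⊕ γ (s[ i ]· γ) i ⟩
      mult γ i + mult (s[ i ]· γ) i ≡⟨ cong₂ _+_ i∈α (trans (mult-s-at-i i γ) i+1∉α) ⟩
      1                       ∎)
    where
    open ≡-Reasoning
    open Critical (Ai⇒Critical γ∈Ai)
    Sγ : IsPosSet γ
    Sγ = IncSeq⇒IsPosSet (proj₁ (proj₁ γ∈Ai))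
    summand-of-η : ∀ {X Y} → A l v X → A l v Y → X ⊕ Y ≡ γ ⊕ s[ i ]· γ → X ≡ γ ⊎ X ≡ s[ i ]· γ
    summand-of-η X∈A Y∈A X⊕Y≡ = halves-of-⊕-s i Sγ i∈α i+1∉α
      (IncSeq⇒IsPosSet (proj₁ X∈A)) (IncSeq⇒IsPosSet (proj₁ Y∈A)) (trans (proj₁ (proj₁ X∈A)) (sym (proj₁ (proj₁ (proj₁ γ∈Ai))))) X⊕Y≡
    α≡β : α ≡ β
    α≡β = two-valued (summand-of-η α∈A β∈A η≡γ⊕sγ) (summand-of-η β∈A α∈A (trans (⊕-comm β α) η≡γ⊕sγ))
      (summand-of-η α′∈A β′∈A (trans (sym η≡) η≡γ⊕sγ)) (α≢α′ ∘ sym) (β≢α′ ∘ sym)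

  Bʷ∪sBʷ∪OffDiagonalSums : ℕ → ℕ → List ℕ → Set
  Bʷ∪sBʷ∪OffDiagonalSums k l η =
    B k l w η ⊎ (∃[ η′ ] B k l w η′ × η ≡ s[ i ]· η′) ⊎ (Sums k l η × (k ≡ l → ¬ Diagonal l η))

  off-diagonal-sum∈Bᵛ : ∀ {k l α β} → Ai l i w α → Ai k i w β → (k ≡ l → ¬ Diagonal l (α ⊕ s[ i ]· β)) →
    B k l v (α ⊕ s[ i ]· β)
  off-diagonal-sum∈Bᵛ {k} {l} {α} {β} α∈Ai β∈Ai off =
    α , s[ i ]· α , s[ i ]· β , β ,
    toAᵛ α∈Aᵛ , toAᵛ (Aᵛ-s α∈Aᵛ) , toAᵛ (Aᵛ-s β∈Aᵛ) , toAᵛ β∈Aᵛ ,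
    refl , η≡sα⊕β ,
    ∈ₘ⇒≢∉ₘ i∈α (trans (mult-s-at-i i α) i+1∉α) , α≢β ,
    α≢β ∘ sym ∘ s-injective i (IncSeq⇒sorted (proj₁ β∈Aᵛ)) (IncSeq⇒sorted (proj₁ α∈Aᵛ)) ,
    ≢-sym (∈ₘ⇒≢∉ₘ i∈β (trans (mult-s-at-i i β) i+1∉β))
    where
    open Critical (Ai⇒Critical α∈Ai)
    open Critical (Ai⇒Critical β∈Ai) using () renaming (i∈α to i∈β; i+1∉α to i+1∉β)
    α∈Aᵛ : Aᵛ l α
    α∈Aᵛ = Aʷ⊆Aᵛ (fromA (proj₁ α∈Ai))
    β∈Aᵛ : Aᵛ k β
    β∈Aᵛ = Aʷ⊆Aᵛ (fromA (proj₁ β∈Ai))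
    α≢β : α ≢ β
    α≢β refl = off (trans (sym (proj₁ (proj₁ β∈Aᵛ))) (proj₁ (proj₁ α∈Aᵛ))) (α , α∈Ai , refl)
    η≡sα⊕β : α ⊕ s[ i ]· β ≡ s[ i ]· α ⊕ β
    η≡sα⊕β = begin
      α ⊕ s[ i ]· β                    ≡⟨ ⊕-comm α _ ⟩
      s[ i ]· β ⊕ α                    ≡⟨ s-fixes-opposites i {s[ i ]· β} {α} (trans (mult-s-at-i i β) i+1∉β)
                                             (trans (mult-s-at-i+1 i β) i∈β) i∈α i+1∉α ⟨
      s[ i ]· (s[ i ]· β ⊕ α)          ≡⟨ s-⊕ i (s[ i ]· β) α ⟩
      s[ i ]· (s[ i ]· β) ⊕ s[ i ]· α  ≡⟨ cong (_⊕ s[ i ]· α) (s-involutive i (IncSeq⇒sorted (proj₁ β∈Aᵛ))) ⟩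
      β ⊕ s[ i ]· α                    ≡⟨ ⊕-comm β _ ⟩
      s[ i ]· α ⊕ β                    ∎
      where open ≡-Reasoning

  ⇒Bᵛ : ∀ {k l η} → Bʷ∪sBʷ∪OffDiagonalSums k l η → B k l v η
  ⇒Bᵛ (inj₁ η∈Bʷ) = Bʷ⊆Bᵛ η∈Bʷ
  ⇒Bᵛ (inj₂ (inj₁ (_ , η′∈Bʷ , refl))) = Bᵛ-s (Bʷ⊆Bᵛ η′∈Bʷ)
  ⇒Bᵛ (inj₂ (inj₂ ((α , β , α∈Ai , β∈Ai , refl) , off))) = off-diagonal-sum∈Bᵛ α∈Ai β∈Ai off

  Tilted : List ℕ → Set
  Tilted η = mult η i ≤ 1 × 0 < mult η (suc i)

  tilted : ∀ {m X Y} → Aᵛ m X → ¬ Aʷ m X → IsPosSet Y → Tilted (X ⊕ Y)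
  tilted {X = X} {Y} X∈Aᵛ X∉Aʷ SY =
    subst (_≤ 1) (sym (trans (mult-⊕ X Y i) (cong (_+ mult Y i) i∉α))) (mult≤1 SY i) ,
    subst (0 <_) (sym (trans (mult-⊕ X Y (suc i)) (cong (_+ mult Y (suc i)) i+1∈α))) (s≤s z≤n)
    where open Fresh (fresh X∈Aᵛ X∉Aʷ)

  tilted-partner : ∀ {X Y} → i ∈ₘ X → suc i ∉ₘ X → IsPosSet Y → Tilted (X ⊕ Y) → i ∉ₘ Y × suc i ∈ₘ Y
  tilted-partner {X} {Y} i∈X i+1∉X SY (i≤1 , i+1>0) =
    n≤0⇒n≡0 (+-cancelˡ-≤ 1 _ 0 (subst (_≤ 1) (trans (mult-⊕ X Y i) (cong (_+ mult Y i) i∈X)) i≤1)) ,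
    ≤-antisym (mult≤1 SY (suc i)) (subst (0 <_) (trans (mult-⊕ X Y (suc i)) (cong (_+ mult Y (suc i)) i+1∉X)) i+1>0)

  pair-in-Aʷ? : ∀ {k l X Y} → Aᵛ l X → Aᵛ k Y → (Aʷ l X × Aʷ k Y) ⊎ Tilted (X ⊕ Y)
  pair-in-Aʷ? {X = X} {Y} X∈Aᵛ Y∈Aᵛ with Aʷ? X∈Aᵛ | Aʷ? Y∈Aᵛ
  ... | yes X∈Aʷ | yes Y∈Aʷ = inj₁ (X∈Aʷ , Y∈Aʷ)
  ... | no X∉Aʷ | _ = inj₂ (tilted X∈Aᵛ X∉Aʷ (IncSeq⇒IsPosSet (proj₁ Y∈Aᵛ)))
  ... | yes _ | no Y∉Aʷ = inj₂ (subst Tilted (⊕-comm Y X) (tilted Y∈Aᵛ Y∉Aʷ (IncSeq⇒IsPosSet (proj₁ X∈Aᵛ))))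

  first-critical : ∀ {k l X Y} → k ≤ l → Aʷ l X → ¬ Aʷ l (s[ i ]· X) → Aᵛ k Y → Tilted (X ⊕ Y) →
    B k l w (X ⊕ Y) ⊎ Sums k l (X ⊕ Y)
  first-critical {k} {l} {X} {Y} k≤l X∈Aʷ sX∉Aʷ Y∈Aᵛ tilt = by (Aʷ? Y∈Aᵛ)
    where
    crit : Critical l X
    crit = critical X∈Aʷ sX∉Aʷ
    i∉Y×i+1∈Y : i ∉ₘ Y × suc i ∈ₘ Y
    i∉Y×i+1∈Y = tilted-partner (Critical.i∈α crit) (Critical.i+1∉α crit) (IncSeq⇒IsPosSet (proj₁ Y∈Aᵛ)) tilt
    by : Dec (Aʷ k Y) → B k l w (X ⊕ Y) ⊎ Sums k l (X ⊕ Y)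
    by (yes Y∈Aʷ) = inj₁ (exchange-above k≤l X∈Aʷ crit Y∈Aʷ (proj₁ i∉Y×i+1∈Y) (proj₂ i∉Y×i+1∈Y))
    by (no Y∉Aʷ) = inj₂ (X , s[ i ]· Y , critical⇒Ai X∈Aʷ sX∉Aʷ , fresh⇒Ai Y∈Aᵛ Y∉Aʷ ,
      cong (X ⊕_) (sym (s-involutive i (IncSeq⇒sorted (proj₁ Y∈Aᵛ)))))

  second-critical : ∀ {k l X Y} → k ≤ l → Aᵛ l X → Aʷ k Y → ¬ Aʷ k (s[ i ]· Y) → Tilted (X ⊕ Y) →
    B k l w (X ⊕ Y) ⊎ Sums k l (X ⊕ Y)
  second-critical {k} {l} {X} {Y} k≤l X∈Aᵛ Y∈Aʷ sY∉Aʷ tilt = by (Aʷ? X∈Aᵛ)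
    where
    crit : Critical k Y
    crit = critical Y∈Aʷ sY∉Aʷ
    open Critical crit using () renaming (i∈α to i∈Y; i+1∉α to i+1∉Y)
    i∉X×i+1∈X : i ∉ₘ X × suc i ∈ₘ X
    i∉X×i+1∈X = tilted-partner i∈Y i+1∉Y (IncSeq⇒IsPosSet (proj₁ X∈Aᵛ)) (subst Tilted (⊕-comm X Y) tilt)
    by : Dec (Aʷ l X) → B k l w (X ⊕ Y) ⊎ Sums k l (X ⊕ Y)
    by (yes X∈Aʷ) = inj₁ (exchange-below k≤l X∈Aʷ (proj₁ i∉X×i+1∈X) (proj₂ i∉X×i+1∈X) Y∈Aʷ crit)
    by (no X∉Aʷ) = inj₂ (s[ i ]· X , Y , fresh⇒Ai X∈Aᵛ X∉Aʷ , critical⇒Ai Y∈Aʷ sY∉Aʷ ,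
      trans (sym (s-fixes-opposites i {X} {Y} (proj₁ i∉X×i+1∈X) (proj₂ i∉X×i+1∈X) i∈Y i+1∉Y)) (s-⊕ i X Y))

  images-in-Aʷ? : ∀ {k l X Y} → k ≤ l → Aᵛ l X → Aᵛ k Y → Tilted (X ⊕ Y) →
    (Aʷ l (s[ i ]· X) × Aʷ k (s[ i ]· Y)) ⊎ B k l w (X ⊕ Y) ⊎ Sums k l (X ⊕ Y)
  images-in-Aʷ? k≤l X∈Aᵛ Y∈Aᵛ tilt with Aʷ? (Aᵛ-s X∈Aᵛ) | Aʷ? (Aᵛ-s Y∈Aᵛ)
  ... | yes sX∈Aʷ | yes sY∈Aʷ = inj₁ (sX∈Aʷ , sY∈Aʷ)
  ... | no sX∉Aʷ | _ = inj₂ (first-critical k≤l (s-image-in-Aʷ X∈Aᵛ sX∉Aʷ) sX∉Aʷ Y∈Aᵛ tilt)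
  ... | yes _ | no sY∉Aʷ = inj₂ (second-critical k≤l X∈Aᵛ (s-image-in-Aʷ Y∈Aᵛ sY∉Aʷ) sY∉Aʷ tilt)

  Bᵛ⇒ : ∀ {k l η} → k ≤ l → B k l v η → Bʷ∪sBʷ∪OffDiagonalSums k l η
  Bᵛ⇒ {k} {l} k≤l η∈Bᵛ@(α , α′ , β , β′ , α∈A , α′∈A , β∈A , β′∈A , refl , η≡ , α≢α′ , α≢β′ , β≢α′ , β≢β′) =
    by-pairs (pair-in-Aʷ? α∈Aᵛ β∈Aᵛ) (pair-in-Aʷ? α′∈Aᵛ β′∈Aᵛ)
    where
    η : List ℕ
    η = α ⊕ β
    α∈Aᵛ : Aᵛ l α
    α∈Aᵛ = fromAᵛ α∈A
    α′∈Aᵛ : Aᵛ l α′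
    α′∈Aᵛ = fromAᵛ α′∈A
    β∈Aᵛ : Aᵛ k β
    β∈Aᵛ = fromAᵛ β∈A
    β′∈Aᵛ : Aᵛ k β′
    β′∈Aᵛ = fromAᵛ β′∈A
    settle : B k l w η ⊎ Sums k l η → Bʷ∪sBʷ∪OffDiagonalSums k l η
    settle (inj₁ η∈Bʷ) = inj₁ η∈Bʷ
    settle (inj₂ η∈Sums) = inj₂ (inj₂ (η∈Sums , off-diagonal η∈Bᵛ))
    images : Aʷ l (s[ i ]· α) × Aʷ k (s[ i ]· β) → Aʷ l (s[ i ]· α′) × Aʷ k (s[ i ]· β′) → Bʷ∪sBʷ∪OffDiagonalSums k l η
    images (sα , sβ) (sα′ , sβ′) = inj₂ (inj₁ (s[ i ]· η ,
      B-rebase {u = v} {u′ = w} (Bᵛ-s η∈Bᵛ) (toA sα) (toA sα′) (toA sβ) (toA sβ′) , sym (s-involutive i (sort-↗ (α ++ β)))))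
    via-images : Tilted η → Bʷ∪sBʷ∪OffDiagonalSums k l η
    via-images tilt with images-in-Aʷ? k≤l α∈Aᵛ β∈Aᵛ tilt | images-in-Aʷ? k≤l α′∈Aᵛ β′∈Aᵛ (subst Tilted η≡ tilt)
    ... | inj₁ sαβ | inj₁ sαβ′ = images sαβ sαβ′
    ... | inj₂ settled | _ = settle settled
    ... | inj₁ _ | inj₂ settled′ = settle (subst (λ η → B k l w η ⊎ Sums k l η) (sym η≡) settled′)
    by-pairs : (Aʷ l α × Aʷ k β) ⊎ Tilted η → (Aʷ l α′ × Aʷ k β′) ⊎ Tilted (α′ ⊕ β′) → Bʷ∪sBʷ∪OffDiagonalSums k l η
    by-pairs (inj₁ (α∈Aʷ , β∈Aʷ)) (inj₁ (α′∈Aʷ , β′∈Aʷ)) =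
      inj₁ (α , α′ , β , β′ , toA α∈Aʷ , toA α′∈Aʷ , toA β∈Aʷ , toA β′∈Aʷ , refl , η≡ , α≢α′ , α≢β′ , β≢α′ , β≢β′)
    by-pairs (inj₂ tilt) _ = via-images tilt
    by-pairs (inj₁ _) (inj₂ tilt′) = via-images (subst Tilted (sym η≡) tilt′)

proposition2p12 : (w : FinPerm) (i : ℕ) .{{_ : NonZero i}} → ℓ w < ℓ (s[ i ]∘ w) →
    (k l : ℕ) → k ≤ l →
    (∀ η → B̃ k l (s[ i ]∘ w) η ⇔
       (B̃ k l w η
        ⊎ (∃[ η' ] B̃ k l w η' × η ≡ s[ i ]· η')
        ⊎ (∃[ α ] ∃[ β ] Ai l i w α × Ai k i w β × η ≡ α ⊕ s[ i ]· β)))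
    × (∀ η → B k l (s[ i ]∘ w) η ⇔
       (B k l w η
        ⊎ (∃[ η' ] B k l w η' × η ≡ s[ i ]· η')
        ⊎ ((∃[ α ] ∃[ β ] Ai l i w α × Ai k i w β × η ≡ α ⊕ s[ i ]· β)
           × (k ≡ l → ¬ (∃[ α ] Ai l i w α × η ≡ α ⊕ s[ i ]· α)))))
    × (∀ η → B̃ k l (s[ i ]∘ w) η → B̃ k l (s[ i ]∘ w) (s[ i ]· η))
    × (∀ η → B k l (s[ i ]∘ w) η → B k l (s[ i ]∘ w) (s[ i ]· η))
proposition2p12 w i ℓ-grows k l k≤l =
  (λ _ → mk⇔ B̃ᵛ⇒ ⇒B̃ᵛ) , (λ _ → mk⇔ (Bᵛ⇒ k≤l) ⇒Bᵛ) , (λ _ → B̃ᵛ-s) , (λ _ → Bᵛ-s)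
  where open Ascent w i (ascent w i ℓ-grows)
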